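{- Let $M$ be a loopless matroid and $F$ a flat of $M$. If either the restriction $M|F$ or the contraction $M/F$ has a non-standard rank-preserving rainbow circuit-free coloring, then so does $M$.
   Context: A coloring of the ground set of a matroid $N$ is a partition into nonempty color classes; it is rainbow circuit-free if every circuit of $N$ contains two elements of the same color, and rank-preserving if the number of colors equals the rank of $N$. A cut is an inclusionwise minimal subset of the ground set meeting every basis. For $N$ of rank $r$, a coloring with $r$ classes is standard if the classes can be indexed $S_1,\dots,S_r$ so that for every $i$, $S_i$ is a cut of $N|(S_1\cup\dots\cup S_i)$. A flat is a set $F$ with $r_M(F+e)>r_M(F)$ for every element $e\notin F$. -}

module Defs where

open import Data.Nat using (ℕ; _<_; _≤_)
open import Data.Fin using (Fin; toℕ) renaming (_≟_ to _≟F_; _≤?_ to _≤?F_)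
open import Data.Fin.Subset using (Subset; _∈_; _∉_; _⊆_; _∪_; _∩_; ∁; ⁅_⁆; ∣_∣; ⊥; Nonempty)
open import Data.Fin.Permutation using (Permutation′; _⟨$⟩ʳ_; _⟨$⟩ˡ_)
open import Data.Vec using (tabulate)
open import Data.Product using (Σ; ∃; _×_; _,_)
open import Relation.Nullary using (¬_; Dec)
open import Relation.Nullary.Decidable using (⌊_⌋)
open import Relation.Binary.PropositionalEquality using (_≡_; _≢_)

record IndepSystem (n : ℕ) : Set₁ where
  field
    ground : Subset n
    Indep  : Subset n → Set

open IndepSystem public

record Matroid (n : ℕ) : Set₁ where
  field
    sys        : IndepSystem n
    indep?     : ∀ X → Dec (Indep sys X)
    indep⊆E    : ∀ {I} → Indep sys I → I ⊆ ground sys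
    indep-∅    : Indep sys ⊥
    indep-down : ∀ {I J} → I ⊆ J → Indep sys J → Indep sys I
    indep-aug  : ∀ {I J} → Indep sys I → Indep sys J → ∣ I ∣ < ∣ J ∣ →
                 ∃ λ x → x ∈ J × x ∉ I × Indep sys (⁅ x ⁆ ∪ I)

open Matroid public

module _ {n : ℕ} (S : IndepSystem n) where

  IsBasisOf : Subset n → Subset n → Set
  IsBasisOf X B = B ⊆ X × Indep S B ×
                  (∀ x → x ∈ X → x ∉ B → ¬ Indep S (⁅ x ⁆ ∪ B))

  IsBasis : Subset n → Set
  IsBasis B = IsBasisOf (ground S) B

  HasRankOf : Subset n → ℕ → Set
  HasRankOf X k = (∃ λ I → I ⊆ X × Indep S I × ∣ I ∣ ≡ k) ×
                  (∀ I → I ⊆ X → Indep S I → ∣ I ∣ ≤ k)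

  HasRank : ℕ → Set
  HasRank k = HasRankOf (ground S) k

  IsCircuit : Subset n → Set
  IsCircuit C = C ⊆ ground S × ¬ Indep S C ×
                (∀ C′ → C′ ⊆ C → ¬ Indep S C′ → C ⊆ C′)

  MeetsEveryBasis : Subset n → Set
  MeetsEveryBasis K = ∀ B → IsBasis B → Nonempty (K ∩ B)

  IsCut : Subset n → Set
  IsCut K = K ⊆ ground S × MeetsEveryBasis K ×
            (∀ K′ → K′ ⊆ K → MeetsEveryBasis K′ → K ⊆ K′)

  Loopless : Set
  Loopless = ∀ e → e ∈ ground S → Indep S ⁅ e ⁆

  IsFlat : Subset n → Set
  IsFlat F = F ⊆ ground S ×
             (∀ e → e ∈ ground S → e ∉ F → ∀ k k′ →
                HasRankOf F k → HasRankOf (⁅ e ⁆ ∪ F) k′ → k < k′)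

  restrict : Subset n → IndepSystem n
  restrict X = record { ground = ground S ∩ X
                      ; Indep  = λ I → Indep S I × I ⊆ X }

  contract : Subset n → IndepSystem n
  contract X = record { ground = ground S ∩ ∁ X
                      ; Indep  = λ I → I ⊆ ground S ∩ ∁ X ×
                                       ∃ λ B → IsBasisOf X B × Indep S (I ∪ B) }

  colourClass : {k : ℕ} → (Fin n → Fin k) → Fin k → Subset n
  colourClass c j = ground S ∩ tabulate (λ x → ⌊ c x ≟F j ⌋)

  -- a colouring of E with k nonempty classes, labelled by Fin k
  -- (values of c outside E are irrelevant)
  IsColouring : (k : ℕ) → (Fin n → Fin k) → Set
  IsColouring k c = ∀ j → ∃ λ x → x ∈ ground S × c x ≡ j

  RainbowCircuitFree : {k : ℕ} → (Fin n → Fin k) → Set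
  RainbowCircuitFree c = ∀ C → IsCircuit C →
    ∃ λ x → ∃ λ y → x ∈ C × y ∈ C × x ≢ y × c x ≡ c y

-- standard: an ordering σ of the colour classes (σ ⟨$⟩ʳ i is the i-th class)
-- such that the i-th class is a cut of S restricted to classes 0..i
IsStandard : {n k : ℕ} → IndepSystem n → (Fin n → Fin k) → Set
IsStandard {n} {k} S c = Σ (Permutation′ k) λ σ → ∀ i →
  IsCut (restrict S (ground S ∩ tabulate (λ x → ⌊ (σ ⟨$⟩ˡ c x) ≤?F i ⌋)))
        (colourClass S c (σ ⟨$⟩ʳ i))


module _ {n : ℕ} (S : IndepSystem n) where

  HasNonStdRPRCFColouring : Set
  HasNonStdRPRCFColouring = ∃ λ k → ∃ λ (c : Fin n → Fin k) →
    IsColouring S k c × HasRank S k × RainbowCircuitFree S c × ¬ IsStandard S c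

module Submission where

-- Since F is a flat, M/F is loopless, and r(M) = r(F) + r(M/F). A loopless matroid has a flag
-- colouring: list the elements and give x the rank of the longest prefix not spanning it. It has
-- r colours and no element is spanned by elements of smaller colour, so every circuit repeats its
-- largest colour. Given a non-standard colouring of one of M|F, M/F, colour the other minor by
-- its flag colouring, with disjoint colours. Every circuit of M is a circuit of M|F or contains a
-- circuit of M/F, so the result is rainbow circuit free, and it has r(F) + r(M/F) = r(M) colours.
-- If it were standard, then in the standard order the first t classes of M meet F in a set whose
-- rank counts the colours of F among them, and together with F they have rank r(F) plus the number
-- of remaining colours among them. Hence the classes of the given colouring, ordered as in M, are
-- complements of hyperplanes in the corresponding restrictions: the given colouring is standard.

open import Defs
open import Data.Bool using (Bool; true; false)
open import Data.Empty using (⊥-elim)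
open import Data.Fin using (Fin; toℕ; fromℕ<; punchOut; _↑ˡ_; _↑ʳ_; splitAt)
  renaming (_≟_ to _≟F_; _≤?_ to _≤?F_; _≤_ to _≤F_)
open import Data.Fin.Permutation using (Permutation′; _⟨$⟩ʳ_; _⟨$⟩ˡ_; inverseˡ; inverseʳ; permutation)
open import Data.Fin.Properties
  using (any?; toℕ-injective; toℕ<n; toℕ-fromℕ<; injective⇒≤; punchOut-injective;
         ↑ˡ-injective; ↑ʳ-injective; toℕ-↑ˡ; toℕ-↑ʳ; splitAt⁻¹-↑ˡ; splitAt⁻¹-↑ʳ)
open import Data.Fin.Subset using (Subset; _∈_; _∉_; _⊆_; _∪_; _∩_; ∁; ⁅_⁆; ∣_∣; ⊥; ⊤; Empty)
open import Data.Fin.Subset.Properties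
  using (_∈?_; _⊆?_; nonempty?; ⊆-refl; ⊆-reflexive; ⊆-trans; ⊆-antisym; ∉⊥; ⊥⊆; ∈⊤; ⊆⊤; Empty-unique;
         ∣⊥∣≡0; ∣⊤∣≡n; ∣⁅x⁆∣≡1; p⊆q⇒∣p∣≤∣q∣; p⊂q⇒∣p∣<∣q∣; x∈⁅x⁆; x∈⁅y⁆⇒x≡y; x≢y⇒x∉⁅y⁆;
         x∈p∩q⁺; x∈p∩q⁻; p∩q⊆p; p∩q⊆q; x∈p∪q⁻; p⊆p∪q; q⊆p∪q; x∈∁p⇒x∉p; x∉p⇒x∈∁p;
         ∪-assoc; ∩-assoc; ∩-comm; ∩-identityˡ; ∩-identityʳ; ∪-identityˡ; ∩-distribʳ-∪)
open import Data.List using (List; []; _∷_; allFin; filter)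
open import Data.List.Extrema.Nat using (argmax; argmax-sel; f[xs]≤f[argmax])
open import Data.List.Membership.Propositional using () renaming (_∈_ to _∈ˡ_)
open import Data.List.Membership.Propositional.Properties using (∈-allFin; ∈-filter⁺; ∈-filter⁻)
open import Data.List.Relation.Unary.All using (lookup)
open import Data.List.Relation.Unary.Any using (here; there)
open import Data.Nat using (ℕ; zero; suc; _+_; _≤_; _<_; z≤n; s≤s; s≤s⁻¹; s<s⁻¹; _≟_; _<?_; _≤?_)
open import Data.Nat.Properties
  using (≤-refl; ≤-reflexive; ≤-trans; ≤-antisym; <-irrefl; <-≤-trans; <-cmp; <⇒≤; <⇒≱; ≮⇒≥; ≰⇒>;
         ≤∧≢⇒<; 1+n≰n; n≮0; n≤0⇒n≡0; n≤1+n; m≤m+n; m≤n+m; m<n⇒m<1+n; m≤n⇒m<n∨m≡n;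
         +-suc; +-identityʳ; +-comm; +-mono-≤; +-monoˡ-≤; +-monoˡ-<; +-cancelˡ-≡; +-cancelʳ-≤; +-cancelʳ-<;
         module ≤-Reasoning)
open import Data.Nat.Solver using (module +-*-Solver)
open import Data.Product using (∃; _×_; _,_; proj₁; proj₂)
open import Data.Sum using (_⊎_; inj₁; inj₂)
open import Data.Vec using (_∷_; []; tabulate)
open import Data.Vec.Properties using (tabulate-cong; lookup∘tabulate; []=⇒lookup; lookup⇒[]=)
open import Function using (_∘_)
open import Function.Bundles using (_⇔_; mk⇔; Equivalence)
open import Relation.Binary.Definitions using (tri<; tri≈; tri>)
open import Relation.Binary.PropositionalEquality
  using (_≡_; _≢_; refl; sym; trans; cong; cong₂; subst; subst₂; module ≡-Reasoning)
open import Relation.Nullary using (¬_; Dec; yes; no)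
open import Relation.Nullary.Decidable using (⌊_⌋; _×-dec_; ¬?; decidable-stable; isYes≗does; dec-true; does-⇔)
open import Relation.Unary using (Decidable)

private variable n : ℕ

∈-tabulate⁺ : ∀ {f : Fin n → Bool} {x} → f x ≡ true → x ∈ tabulate f
∈-tabulate⁺ {f = f} {x} fx = lookup⇒[]= x (tabulate f) (trans (lookup∘tabulate f x) fx)

∈-tabulate⁻ : ∀ {f : Fin n → Bool} {x} → x ∈ tabulate f → f x ≡ true
∈-tabulate⁻ {f = f} {x} x∈ = trans (sym (lookup∘tabulate f x)) ([]=⇒lookup x∈)

module _ {ℓ} {P : Fin n → Set ℓ} (P? : Decidable P) where

  ∈-select⁺ : ∀ {x} → P x → x ∈ tabulate (λ y → ⌊ P? y ⌋)
  ∈-select⁺ {x} px = ∈-tabulate⁺ {f = λ y → ⌊ P? y ⌋} (trans (isYes≗does (P? x)) (dec-true (P? x) px))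

  ∈-select⁻ : ∀ {x} → x ∈ tabulate (λ y → ⌊ P? y ⌋) → P x
  ∈-select⁻ {x} x∈ with P? x | ∈-tabulate⁻ {f = λ y → ⌊ P? y ⌋} x∈
  ... | yes px | _ = px
  ... | no _ | ()

∪-least : ∀ {p q r : Subset n} → p ⊆ r → q ⊆ r → p ∪ q ⊆ r
∪-least {p = p} {q} p⊆r q⊆r x∈ with x∈p∪q⁻ p q x∈
... | inj₁ x∈p = p⊆r x∈p
... | inj₂ x∈q = q⊆r x∈q

∪-monoʳ : ∀ (p : Subset n) {q r} → q ⊆ r → p ∪ q ⊆ p ∪ r
∪-monoʳ p q⊆r = ∪-least (p⊆p∪q _) (λ x∈ → q⊆p∪q p _ (q⊆r x∈))

∪-monoˡ : ∀ {p q : Subset n} (r : Subset n) → p ⊆ q → p ∪ r ⊆ q ∪ r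
∪-monoˡ r p⊆q = ∪-least (λ x∈ → p⊆p∪q r (p⊆q x∈)) (q⊆p∪q _ r)

∩-greatest : ∀ {p q r : Subset n} → r ⊆ p → r ⊆ q → r ⊆ p ∩ q
∩-greatest r⊆p r⊆q x∈ = x∈p∩q⁺ (r⊆p x∈ , r⊆q x∈)

⁅x⁆⊆ : ∀ {x : Fin n} {p} → x ∈ p → ⁅ x ⁆ ⊆ p
⁅x⁆⊆ {x = x} x∈p y∈ = subst (_∈ _) (sym (x∈⁅y⁆⇒x≡y x y∈)) x∈p

⁅x⁆∪p≡p : ∀ {x : Fin n} {p} → x ∈ p → ⁅ x ⁆ ∪ p ≡ p
⁅x⁆∪p≡p x∈p = ⊆-antisym (∪-least (⁅x⁆⊆ x∈p) ⊆-refl) (q⊆p∪q _ _)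

x∉p∩∁⁅x⁆ : ∀ {x : Fin n} {p} → x ∉ p ∩ ∁ ⁅ x ⁆
x∉p∩∁⁅x⁆ {x = x} x∈ = x∈∁p⇒x∉p (p∩q⊆q _ _ x∈) (x∈⁅x⁆ x)

x∈p⇒∣p∩∁⁅x⁆∣<∣p∣ : ∀ {x : Fin n} {p} → x ∈ p → ∣ p ∩ ∁ ⁅ x ⁆ ∣ < ∣ p ∣
x∈p⇒∣p∩∁⁅x⁆∣<∣p∣ {x = x} {p} x∈p = p⊂q⇒∣p∣<∣q∣ (p∩q⊆p p _ , x , x∈p , x∉p∩∁⁅x⁆)

⁅x⁆∪p∩∁⁅x⁆≡p : ∀ {x : Fin n} {p} → x ∈ p → ⁅ x ⁆ ∪ (p ∩ ∁ ⁅ x ⁆) ≡ p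
⁅x⁆∪p∩∁⁅x⁆≡p {x = x} {p} x∈p = ⊆-antisym (∪-least (⁅x⁆⊆ x∈p) (p∩q⊆p p _)) ⊇
  where
  ⊇ : p ⊆ ⁅ x ⁆ ∪ (p ∩ ∁ ⁅ x ⁆)
  ⊇ {y} y∈ with y ≟F x
  ... | yes refl = p⊆p∪q _ (x∈⁅x⁆ x)
  ... | no y≢x = q⊆p∪q _ _ (x∈p∩q⁺ (y∈ , x∉p⇒x∈∁p (x≢y⇒x∉⁅y⁆ y≢x)))

p⊆p∩∁q∪q : ∀ (p q : Subset n) → p ⊆ (p ∩ ∁ q) ∪ q
p⊆p∩∁q∪q p q {x} x∈ with x ∈? q
... | yes x∈q = q⊆p∪q _ q x∈q
... | no x∉q = p⊆p∪q q (x∈p∩q⁺ (x∈ , x∉p⇒x∈∁p x∉q))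

∣p∪q∣+∣p∩q∣≡∣p∣+∣q∣ : ∀ (p q : Subset n) → ∣ p ∪ q ∣ + ∣ p ∩ q ∣ ≡ ∣ p ∣ + ∣ q ∣
∣p∪q∣+∣p∩q∣≡∣p∣+∣q∣ [] [] = refl
∣p∪q∣+∣p∩q∣≡∣p∣+∣q∣ (true ∷ p) (true ∷ q) = cong suc (begin
  ∣ p ∪ q ∣ + suc ∣ p ∩ q ∣   ≡⟨ +-suc ∣ p ∪ q ∣ ∣ p ∩ q ∣ ⟩
  suc (∣ p ∪ q ∣ + ∣ p ∩ q ∣) ≡⟨ cong suc (∣p∪q∣+∣p∩q∣≡∣p∣+∣q∣ p q) ⟩
  suc (∣ p ∣ + ∣ q ∣)         ≡⟨ +-suc ∣ p ∣ ∣ q ∣ ⟨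
  ∣ p ∣ + suc ∣ q ∣           ∎)
  where open ≡-Reasoning
∣p∪q∣+∣p∩q∣≡∣p∣+∣q∣ (true ∷ p) (false ∷ q) = cong suc (∣p∪q∣+∣p∩q∣≡∣p∣+∣q∣ p q)
∣p∪q∣+∣p∩q∣≡∣p∣+∣q∣ (false ∷ p) (true ∷ q) =
  trans (cong suc (∣p∪q∣+∣p∩q∣≡∣p∣+∣q∣ p q)) (sym (+-suc ∣ p ∣ ∣ q ∣))
∣p∪q∣+∣p∩q∣≡∣p∣+∣q∣ (false ∷ p) (false ∷ q) = ∣p∪q∣+∣p∩q∣≡∣p∣+∣q∣ p q

∣p∪q∣≤∣p∣+∣q∣ : ∀ (p q : Subset n) → ∣ p ∪ q ∣ ≤ ∣ p ∣ + ∣ q ∣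
∣p∪q∣≤∣p∣+∣q∣ p q = subst (∣ p ∪ q ∣ ≤_) (∣p∪q∣+∣p∩q∣≡∣p∣+∣q∣ p q) (m≤m+n _ _)

disjoint⇒∣p∪q∣≡∣p∣+∣q∣ : ∀ {p q : Subset n} → Empty (p ∩ q) → ∣ p ∪ q ∣ ≡ ∣ p ∣ + ∣ q ∣
disjoint⇒∣p∪q∣≡∣p∣+∣q∣ {n} {p} {q} disjoint = begin
  ∣ p ∪ q ∣                ≡⟨ +-identityʳ _ ⟨
  ∣ p ∪ q ∣ + 0            ≡⟨ cong (∣ p ∪ q ∣ +_) ∣p∩q∣≡0 ⟨
  ∣ p ∪ q ∣ + ∣ p ∩ q ∣     ≡⟨ ∣p∪q∣+∣p∩q∣≡∣p∣+∣q∣ p q ⟩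
  ∣ p ∣ + ∣ q ∣             ∎
  where
  open ≡-Reasoning
  ∣p∩q∣≡0 : ∣ p ∩ q ∣ ≡ 0
  ∣p∩q∣≡0 = trans (cong ∣_∣ (Empty-unique disjoint)) (∣⊥∣≡0 n)

∣⁅x⁆∪p∣≡1+∣p∣ : ∀ {x : Fin n} {p} → x ∉ p → ∣ ⁅ x ⁆ ∪ p ∣ ≡ suc ∣ p ∣
∣⁅x⁆∪p∣≡1+∣p∣ {x = x} {p} x∉p = trans (disjoint⇒∣p∪q∣≡∣p∣+∣q∣ disjoint) (cong (_+ ∣ p ∣) (∣⁅x⁆∣≡1 x))
  where
  disjoint : Empty (⁅ x ⁆ ∩ p)
  disjoint (y , y∈) with x∈p∩q⁻ ⁅ x ⁆ p y∈
  ... | y∈⁅x⁆ , y∈p = x∉p (subst (_∈ p) (x∈⁅y⁆⇒x≡y x y∈⁅x⁆) y∈p)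

∣p∩q∣+∣p∩∁q∣≡∣p∣ : ∀ (p q : Subset n) → ∣ p ∩ q ∣ + ∣ p ∩ ∁ q ∣ ≡ ∣ p ∣
∣p∩q∣+∣p∩∁q∣≡∣p∣ [] [] = refl
∣p∩q∣+∣p∩∁q∣≡∣p∣ (true ∷ p) (true ∷ q) = cong suc (∣p∩q∣+∣p∩∁q∣≡∣p∣ p q)
∣p∩q∣+∣p∩∁q∣≡∣p∣ (true ∷ p) (false ∷ q) = trans (+-suc _ _) (cong suc (∣p∩q∣+∣p∩∁q∣≡∣p∣ p q))
∣p∩q∣+∣p∩∁q∣≡∣p∣ (false ∷ p) (b ∷ q) = ∣p∩q∣+∣p∩∁q∣≡∣p∣ p q

∣toℕ<m∣≡m : ∀ m k → ∣ tabulate {n = m + k} (λ j → ⌊ toℕ j <? m ⌋) ∣ ≡ m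
∣toℕ<m∣≡m zero k = trans (cong ∣_∣ (Empty-unique none)) (∣⊥∣≡0 k)
  where
  none : Empty (tabulate {n = k} (λ j → ⌊ toℕ j <? 0 ⌋))
  none (j , j∈) = n≮0 (∈-select⁻ (λ j → toℕ j <? 0) j∈)
∣toℕ<m∣≡m (suc m) k = cong suc (trans (cong ∣_∣ (tabulate-cong {n = m + k} λ j → shift (toℕ j))) (∣toℕ<m∣≡m m k))
  where
  shift : ∀ a → ⌊ suc a <? suc m ⌋ ≡ ⌊ a <? m ⌋
  shift a = trans (isYes≗does (suc a <? suc m))
                  (trans (does-⇔ (mk⇔ s<s⁻¹ s≤s) (suc a <? suc m) (a <? m)) (sym (isYes≗does (a <? m))))

⊆-∧-∣∣≤⇒⊇ : ∀ {p q : Subset n} → p ⊆ q → ∣ q ∣ ≤ ∣ p ∣ → q ⊆ p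
⊆-∧-∣∣≤⇒⊇ {p = p} {q} p⊆q ∣q∣≤∣p∣ {x} x∈q with x ∈? p
... | yes x∈p = x∈p
... | no x∉p = ⊥-elim (<⇒≱ (p⊂q⇒∣p∣<∣q∣ (p⊆q , x , x∈q , x∉p)) ∣q∣≤∣p∣)

-- The rank function of a matroid

module Rank (N : Matroid n) where

  S : IndepSystem n
  S = sys N

  E : Subset n
  E = ground S

  Ind : Subset n → Set
  Ind = Indep S

  greedy : List (Fin n) → Subset n → Subset n → Subset n
  greedy [] X J = J
  greedy (x ∷ xs) X J with (x ∈? X) ×-dec indep? N (⁅ x ⁆ ∪ J)
  ... | yes _ = greedy xs X (⁅ x ⁆ ∪ J)
  ... | no _ = greedy xs X J

  ⊆-greedy : ∀ xs X J → J ⊆ greedy xs X J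
  ⊆-greedy [] X J = ⊆-refl
  ⊆-greedy (x ∷ xs) X J with (x ∈? X) ×-dec indep? N (⁅ x ⁆ ∪ J)
  ... | yes _ = ⊆-trans (q⊆p∪q ⁅ x ⁆ J) (⊆-greedy xs X _)
  ... | no _ = ⊆-greedy xs X J

  greedy-indep : ∀ xs X J → Ind J → Ind (greedy xs X J)
  greedy-indep [] X J J-ind = J-ind
  greedy-indep (x ∷ xs) X J J-ind with (x ∈? X) ×-dec indep? N (⁅ x ⁆ ∪ J)
  ... | yes (_ , xJ-ind) = greedy-indep xs X _ xJ-ind
  ... | no _ = greedy-indep xs X J J-ind

  greedy-⊆ : ∀ xs X J → J ⊆ X → greedy xs X J ⊆ X
  greedy-⊆ [] X J J⊆X = J⊆X
  greedy-⊆ (x ∷ xs) X J J⊆X with (x ∈? X) ×-dec indep? N (⁅ x ⁆ ∪ J)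
  ... | yes (x∈X , _) = greedy-⊆ xs X _ (∪-least (⁅x⁆⊆ x∈X) J⊆X)
  ... | no _ = greedy-⊆ xs X J J⊆X

  greedy-maximal : ∀ xs X J x → x ∈ˡ xs → x ∈ X → x ∉ greedy xs X J → ¬ Ind (⁅ x ⁆ ∪ greedy xs X J)
  greedy-maximal (y ∷ xs) X J x (here refl) x∈X x∉ with (x ∈? X) ×-dec indep? N (⁅ x ⁆ ∪ J)
  ... | yes _ = ⊥-elim (x∉ (⊆-greedy xs X _ (p⊆p∪q J (x∈⁅x⁆ x))))
  ... | no ¬xJ-ind = λ ind → ¬xJ-ind (x∈X , indep-down N (∪-monoʳ ⁅ x ⁆ (⊆-greedy xs X J)) ind)
  greedy-maximal (y ∷ xs) X J x (there x∈xs) x∈X x∉ with (y ∈? X) ×-dec indep? N (⁅ y ⁆ ∪ J)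
  ... | yes _ = greedy-maximal xs X _ x x∈xs x∈X x∉
  ... | no _ = greedy-maximal xs X J x x∈xs x∈X x∉

  extend : Subset n → Subset n → Subset n
  extend X J = greedy (allFin n) X J

  ⊆-extend : ∀ X J → J ⊆ extend X J
  ⊆-extend X J = ⊆-greedy (allFin n) X J

  extend-isBasisOf : ∀ {X J} → Ind J → J ⊆ X → IsBasisOf S X (extend X J)
  extend-isBasisOf {X} {J} J-ind J⊆X =
    greedy-⊆ (allFin n) X J J⊆X , greedy-indep (allFin n) X J J-ind ,
    λ x x∈X x∉ → greedy-maximal (allFin n) X J x (∈-allFin x) x∈X x∉

  basis : Subset n → Subset n
  basis X = extend X ⊥

  basis-isBasisOf : ∀ X → IsBasisOf S X (basis X)
  basis-isBasisOf X = extend-isBasisOf (indep-∅ N) (λ x∈⊥ → ⊥-elim (∉⊥ x∈⊥))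

  basis⊆ : ∀ X → basis X ⊆ X
  basis⊆ X = proj₁ (basis-isBasisOf X)

  basis-indep : ∀ X → Ind (basis X)
  basis-indep X = proj₁ (proj₂ (basis-isBasisOf X))

  rk : Subset n → ℕ
  rk X = ∣ basis X ∣

  ∣indep∣≤∣basis∣ : ∀ {X B J} → IsBasisOf S X B → Ind J → J ⊆ X → ∣ J ∣ ≤ ∣ B ∣
  ∣indep∣≤∣basis∣ (_ , B-ind , B-max) J-ind J⊆X = ≮⇒≥ λ ∣B∣<∣J∣ →
    let (x , x∈J , x∉B , xB-ind) = indep-aug N B-ind J-ind ∣B∣<∣J∣
    in B-max x (J⊆X x∈J) x∉B xB-ind

  ∣indep∣≤rk : ∀ {X J} → Ind J → J ⊆ X → ∣ J ∣ ≤ rk X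
  ∣indep∣≤rk {X} = ∣indep∣≤∣basis∣ (basis-isBasisOf X)

  ∣basis∣≡rk : ∀ {X B} → IsBasisOf S X B → ∣ B ∣ ≡ rk X
  ∣basis∣≡rk {X} B-basis@(B⊆X , B-ind , _) =
    ≤-antisym (∣indep∣≤rk B-ind B⊆X) (∣indep∣≤∣basis∣ B-basis (basis-indep X) (basis⊆ X))

  rk-hasRankOf : ∀ X → HasRankOf S X (rk X)
  rk-hasRankOf X = (basis X , basis⊆ X , basis-indep X , refl) , λ _ I⊆X I-ind → ∣indep∣≤rk I-ind I⊆X

  hasRankOf⇒≡rk : ∀ {X k} → HasRankOf S X k → k ≡ rk X
  hasRankOf⇒≡rk {X} ((I , I⊆X , I-ind , refl) , maximum) =
    ≤-antisym (∣indep∣≤rk I-ind I⊆X) (maximum (basis X) (basis⊆ X) (basis-indep X))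

  rk-mono : ∀ {X Y} → X ⊆ Y → rk X ≤ rk Y
  rk-mono {X} X⊆Y = ∣indep∣≤rk (basis-indep X) (⊆-trans (basis⊆ X) X⊆Y)

  rk≤∣∣ : ∀ X → rk X ≤ ∣ X ∣
  rk≤∣∣ X = p⊆q⇒∣p∣≤∣q∣ (basis⊆ X)

  indep⇒rk≡∣∣ : ∀ {I} → Ind I → rk I ≡ ∣ I ∣
  indep⇒rk≡∣∣ {I} I-ind = ≤-antisym (rk≤∣∣ I) (∣indep∣≤rk I-ind ⊆-refl)

  ∣∣≤rk⇒indep : ∀ {I} → ∣ I ∣ ≤ rk I → Ind I
  ∣∣≤rk⇒indep {I} ∣I∣≤rk = indep-down N (⊆-∧-∣∣≤⇒⊇ (basis⊆ I) ∣I∣≤rk) (basis-indep I)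

  dep⇒rk<∣∣ : ∀ {I} → ¬ Ind I → rk I < ∣ I ∣
  dep⇒rk<∣∣ dep = ≰⇒> λ ∣I∣≤rk → dep (∣∣≤rk⇒indep ∣I∣≤rk)

  indep-⊆-∧-rk≤⇒isBasisOf : ∀ {X C} → C ⊆ X → Ind C → rk X ≤ ∣ C ∣ → IsBasisOf S X C
  indep-⊆-∧-rk≤⇒isBasisOf {X} {C} C⊆X C-ind rk≤ = C⊆X , C-ind , λ z z∈X z∉C zC-ind →
    1+n≰n (≤-trans (subst (_≤ rk X) (∣⁅x⁆∪p∣≡1+∣p∣ z∉C) (∣indep∣≤rk zC-ind (∪-least (⁅x⁆⊆ z∈X) C⊆X))) rk≤)

  rk-submodular : ∀ X Y → rk (X ∪ Y) + rk (X ∩ Y) ≤ rk X + rk Y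
  rk-submodular X Y = begin
    rk (X ∪ Y) + rk (X ∩ Y)              ≡⟨ cong₂ _+_ (∣basis∣≡rk B∪-basis) (∣basis∣≡rk (basis-isBasisOf (X ∩ Y))) ⟨
    ∣ B∪ ∣ + ∣ B∩ ∣                        ≤⟨ +-mono-≤ (p⊆q⇒∣p∣≤∣q∣ B∪⊆) (p⊆q⇒∣p∣≤∣q∣ B∩⊆) ⟩
    ∣ BX ∪ (B∪ ∩ Y) ∣ + ∣ BX ∩ (B∪ ∩ Y) ∣   ≡⟨ ∣p∪q∣+∣p∩q∣≡∣p∣+∣q∣ BX (B∪ ∩ Y) ⟩
    ∣ BX ∣ + ∣ B∪ ∩ Y ∣                    ≤⟨ +-mono-≤ (≤-reflexive (∣basis∣≡rk BX-basis))
                                                        (∣indep∣≤rk B∪∩Y-ind (p∩q⊆q B∪ Y)) ⟩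
    rk X + rk Y                           ∎
    where
    open ≤-Reasoning
    B∩ = basis (X ∩ Y)
    BX = extend X B∩
    B∪ = extend (X ∪ Y) BX
    BX-basis : IsBasisOf S X BX
    BX-basis = extend-isBasisOf (basis-indep (X ∩ Y)) (⊆-trans (basis⊆ (X ∩ Y)) (p∩q⊆p X Y))
    B∪-basis : IsBasisOf S (X ∪ Y) B∪
    B∪-basis = extend-isBasisOf (proj₁ (proj₂ BX-basis)) (⊆-trans (proj₁ BX-basis) (p⊆p∪q Y))
    B∪-ind = proj₁ (proj₂ B∪-basis)
    B∪∩Y-ind = indep-down N (p∩q⊆p B∪ Y) B∪-ind
    B∩⊆ : B∩ ⊆ BX ∩ (B∪ ∩ Y)
    B∩⊆ b∈ = let b∈BX = ⊆-extend X B∩ b∈ in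
      x∈p∩q⁺ (b∈BX , x∈p∩q⁺ (⊆-extend (X ∪ Y) BX b∈BX , p∩q⊆q X Y (basis⊆ (X ∩ Y) b∈)))
    B∪⊆ : B∪ ⊆ BX ∪ (B∪ ∩ Y)
    B∪⊆ {b} b∈ with x∈p∪q⁻ X Y (proj₁ B∪-basis b∈) | b ∈? BX
    ... | inj₂ b∈Y | _ = q⊆p∪q _ _ (x∈p∩q⁺ (b∈ , b∈Y))
    ... | inj₁ _ | yes b∈BX = p⊆p∪q _ b∈BX
    ... | inj₁ b∈X | no b∉BX = ⊥-elim (proj₂ (proj₂ BX-basis) b b∈X b∉BX
                                  (indep-down N (∪-least (⁅x⁆⊆ b∈) (⊆-extend (X ∪ Y) BX)) B∪-ind))

  rk-∪≤ : ∀ X Y → rk (X ∪ Y) ≤ rk X + rk Y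
  rk-∪≤ X Y = ≤-trans (m≤m+n _ _) (rk-submodular X Y)

  rk-⁅x⁆∪≤ : ∀ x X → rk (⁅ x ⁆ ∪ X) ≤ suc (rk X)
  rk-⁅x⁆∪≤ x X = begin
    rk (⁅ x ⁆ ∪ X)                       ≤⟨ rk-∪≤ ⁅ x ⁆ X ⟩
    rk ⁅ x ⁆ + rk X                      ≤⟨ +-monoˡ-≤ (rk X) (≤-trans (rk≤∣∣ ⁅ x ⁆) (≤-reflexive (∣⁅x⁆∣≡1 x))) ⟩
    suc (rk X)                           ∎
    where open ≤-Reasoning

  -- rk A < rk (⁅ x ⁆ ∪ A) encodes x ∉ cl A; submodularity for ⁅ x ⁆ ∪ A and Y gives cl A ⊆ cl Y
  unspanned-antitone : ∀ {x A Y} → A ⊆ Y → rk Y < rk (⁅ x ⁆ ∪ Y) → rk A < rk (⁅ x ⁆ ∪ A)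
  unspanned-antitone {x} {A} {Y} A⊆Y rkY< = +-cancelʳ-< (rk Y) (rk A) (rk (⁅ x ⁆ ∪ A)) (begin-strict
    rk A + rk Y                                ≡⟨ +-comm (rk A) (rk Y) ⟩
    rk Y + rk A                                <⟨ +-monoˡ-< (rk A) rkY< ⟩
    rk (⁅ x ⁆ ∪ Y) + rk A                       ≤⟨ +-mono-≤ (rk-mono (∪-monoˡ Y (p⊆p∪q A))) (rk-mono A⊆) ⟩
    rk ((⁅ x ⁆ ∪ A) ∪ Y) + rk ((⁅ x ⁆ ∪ A) ∩ Y) ≤⟨ rk-submodular (⁅ x ⁆ ∪ A) Y ⟩
    rk (⁅ x ⁆ ∪ A) + rk Y                       ∎)
    where
    open ≤-Reasoning
    A⊆ : A ⊆ (⁅ x ⁆ ∪ A) ∩ Y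
    A⊆ a∈ = x∈p∩q⁺ (q⊆p∪q _ A a∈ , A⊆Y a∈)

  rk-∪-spanned : ∀ {Q A} → (∀ a → a ∈ A → rk (⁅ a ⁆ ∪ Q) ≤ rk Q) → rk (Q ∪ A) ≡ rk Q
  rk-∪-spanned {Q} {A} spanned = sym (∣basis∣≡rk (⊆-trans (basis⊆ Q) (p⊆p∪q A) , basis-indep Q , maximal))
    where
    maximal : ∀ z → z ∈ Q ∪ A → z ∉ basis Q → ¬ Ind (⁅ z ⁆ ∪ basis Q)
    maximal z z∈ z∉ zB-ind with x∈p∪q⁻ Q A z∈
    ... | inj₁ z∈Q = proj₂ (proj₂ (basis-isBasisOf Q)) z z∈Q z∉ zB-ind
    ... | inj₂ z∈A = 1+n≰n (≤-trans (subst (_≤ rk (⁅ z ⁆ ∪ Q)) (∣⁅x⁆∪p∣≡1+∣p∣ z∉)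
                      (∣indep∣≤rk zB-ind (∪-monoʳ ⁅ z ⁆ (basis⊆ Q)))) (spanned z z∈A))

  unspanned⇒indep-⁅x⁆∪ : ∀ {x I} → Ind I → rk I < rk (⁅ x ⁆ ∪ I) → Ind (⁅ x ⁆ ∪ I)
  unspanned⇒indep-⁅x⁆∪ {x} {I} I-ind rkI< = ∣∣≤rk⇒indep (begin
    ∣ ⁅ x ⁆ ∪ I ∣   ≤⟨ ∣p∪q∣≤∣p∣+∣q∣ ⁅ x ⁆ I ⟩
    ∣ ⁅ x ⁆ ∣ + ∣ I ∣ ≡⟨ cong₂ _+_ (∣⁅x⁆∣≡1 x) (sym (indep⇒rk≡∣∣ I-ind)) ⟩
    suc (rk I)     ≤⟨ rkI< ⟩
    rk (⁅ x ⁆ ∪ I) ∎)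
    where open ≤-Reasoning

  spanned-mono : ∀ {x A Y} → A ⊆ Y → rk (⁅ x ⁆ ∪ A) ≤ rk A → rk (⁅ x ⁆ ∪ Y) ≤ rk Y
  spanned-mono A⊆Y spannedA = ≮⇒≥ λ rkY< → <⇒≱ (unspanned-antitone A⊆Y rkY<) spannedA

  basis-spans : ∀ {X B a} → IsBasisOf S X B → a ∈ X → rk (⁅ a ⁆ ∪ B) ≤ rk B
  basis-spans {X} {B} {a} (B⊆X , B-ind , B-max) a∈X with a ∈? B
  ... | yes a∈B = ≤-reflexive (cong rk (⁅x⁆∪p≡p a∈B))
  ... | no a∉B = ≮⇒≥ λ rkB< → B-max a a∈X a∉B (unspanned⇒indep-⁅x⁆∪ B-ind rkB<)

  rk-∪-basis : ∀ {X B} Z → IsBasisOf S X B → rk (Z ∪ X) ≡ rk (Z ∪ B)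
  rk-∪-basis {X} {B} Z B-basis = ≤-antisym (begin
    rk (Z ∪ X)         ≤⟨ rk-mono (∪-least (λ z∈ → p⊆p∪q X (p⊆p∪q B z∈)) (q⊆p∪q _ X)) ⟩
    rk ((Z ∪ B) ∪ X)   ≡⟨ rk-∪-spanned (λ a a∈X → spanned-mono (q⊆p∪q Z B) (basis-spans B-basis a∈X)) ⟩
    rk (Z ∪ B)         ∎) (rk-mono (∪-monoʳ Z (proj₁ B-basis)))
    where open ≤-Reasoning

-- Restriction and contraction

restriction : Matroid n → Subset n → Matroid n
restriction N X = record
  { sys = restrict (sys N) X
  ; indep? = λ I → indep? N I ×-dec (I ⊆? X)
  ; indep⊆E = λ (I-ind , I⊆X) x∈I → x∈p∩q⁺ (indep⊆E N I-ind x∈I , I⊆X x∈I)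
  ; indep-∅ = indep-∅ N , λ x∈⊥ → ⊥-elim (∉⊥ x∈⊥)
  ; indep-down = λ I⊆J (J-ind , J⊆X) → indep-down N I⊆J J-ind , ⊆-trans I⊆J J⊆X
  ; indep-aug = λ (I-ind , I⊆X) (J-ind , J⊆X) ∣I∣<∣J∣ →
      let (x , x∈J , x∉I , xI-ind) = indep-aug N I-ind J-ind ∣I∣<∣J∣
      in x , x∈J , x∉I , xI-ind , ∪-least (⁅x⁆⊆ (J⊆X x∈J)) I⊆X
  }

rk-restriction : ∀ (N : Matroid n) X Y → Rank.rk (restriction N X) Y ≡ Rank.rk N (Y ∩ X)
rk-restriction N X Y = sym (Rank.hasRankOf⇒≡rk (restriction N X)
  ( (B , ⊆-trans (basis⊆ (Y ∩ X)) (p∩q⊆p Y X) , (basis-indep (Y ∩ X) , ⊆-trans (basis⊆ (Y ∩ X)) (p∩q⊆q Y X)) , refl)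
  , λ I I⊆Y (I-ind , I⊆X) → ∣indep∣≤rk I-ind (∩-greatest I⊆Y I⊆X)))
  where
  open Rank N
  B = basis (Y ∩ X)

rk-restriction-⊆ : ∀ (N : Matroid n) {X Y} → Y ⊆ X → Rank.rk (restriction N X) Y ≡ Rank.rk N Y
rk-restriction-⊆ N {X} {Y} Y⊆X =
  trans (rk-restriction N X Y) (cong (Rank.rk N) (⊆-antisym (p∩q⊆p Y X) (∩-greatest ⊆-refl Y⊆X)))

module Contraction (N : Matroid n) (F : Subset n) where
  open Rank N

  ∣∣-∪-basis : ∀ {I B} → I ⊆ E ∩ ∁ F → B ⊆ F → ∣ I ∪ B ∣ ≡ ∣ I ∣ + ∣ B ∣
  ∣∣-∪-basis I⊆ B⊆F = disjoint⇒∣p∪q∣≡∣p∣+∣q∣ λ (x , x∈) →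
    let (x∈I , x∈B) = x∈p∩q⁻ _ _ x∈ in x∈∁p⇒x∉p (p∩q⊆q _ _ (I⊆ x∈I)) (B⊆F x∈B)

  indep-∪-basis-swap : ∀ {I B B′} → I ⊆ E ∩ ∁ F → IsBasisOf S F B → IsBasisOf S F B′ → Ind (I ∪ B) → Ind (I ∪ B′)
  indep-∪-basis-swap {I} {B} {B′} I⊆ B-basis B′-basis IB-ind = ∣∣≤rk⇒indep (begin
    ∣ I ∪ B′ ∣      ≡⟨ ∣∣-∪-basis I⊆ (proj₁ B′-basis) ⟩
    ∣ I ∣ + ∣ B′ ∣  ≡⟨ cong (∣ I ∣ +_) (trans (∣basis∣≡rk B′-basis) (sym (∣basis∣≡rk B-basis))) ⟩
    ∣ I ∣ + ∣ B ∣   ≡⟨ ∣∣-∪-basis I⊆ (proj₁ B-basis) ⟨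
    ∣ I ∪ B ∣       ≡⟨ indep⇒rk≡∣∣ IB-ind ⟨
    rk (I ∪ B)      ≡⟨ rk-∪-basis I B-basis ⟨
    rk (I ∪ F)      ≡⟨ rk-∪-basis I B′-basis ⟩
    rk (I ∪ B′)     ∎)
    where open ≤-Reasoning

  private
    CInd : Subset n → Set
    CInd = Indep (contract S F)

  cindep? : ∀ I → Dec (CInd I)
  cindep? I with (I ⊆? (E ∩ ∁ F)) ×-dec indep? N (I ∪ basis F)
  ... | yes (I⊆ , ind) = yes (I⊆ , basis F , basis-isBasisOf F , ind)
  ... | no ¬ind = no λ (I⊆ , B , B-basis , ind) → ¬ind (I⊆ , indep-∪-basis-swap I⊆ B-basis (basis-isBasisOf F) ind)

  cindep-aug : ∀ {I J} → CInd I → CInd J → ∣ I ∣ < ∣ J ∣ → ∃ λ x → x ∈ J × x ∉ I × CInd (⁅ x ⁆ ∪ I)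
  cindep-aug {I} {J} (I⊆ , B , B-basis , IB-ind) (J⊆ , B′ , B′-basis , JB′-ind) ∣I∣<∣J∣
    with indep-aug N IB-ind JB′-ind ∣IB∣<∣JB′∣
    where
    ∣IB∣<∣JB′∣ : ∣ I ∪ B ∣ < ∣ J ∪ B′ ∣
    ∣IB∣<∣JB′∣ = begin-strict
      ∣ I ∪ B ∣      ≡⟨ ∣∣-∪-basis I⊆ (proj₁ B-basis) ⟩
      ∣ I ∣ + ∣ B ∣  <⟨ +-monoˡ-< ∣ B ∣ ∣I∣<∣J∣ ⟩
      ∣ J ∣ + ∣ B ∣  ≡⟨ cong (∣ J ∣ +_) (trans (∣basis∣≡rk B-basis) (sym (∣basis∣≡rk B′-basis))) ⟩
      ∣ J ∣ + ∣ B′ ∣ ≡⟨ ∣∣-∪-basis J⊆ (proj₁ B′-basis) ⟨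
      ∣ J ∪ B′ ∣     ∎
      where open ≤-Reasoning
  ... | x , x∈JB′ , x∉IB , xIB-ind with x∈p∪q⁻ J B′ x∈JB′
  ...   | inj₁ x∈J = x , x∈J , (λ x∈I → x∉IB (p⊆p∪q B x∈I)) , ∪-least (⁅x⁆⊆ (J⊆ x∈J)) I⊆ , B , B-basis ,
                     subst Ind (sym (∪-assoc ⁅ x ⁆ I B)) xIB-ind
  ...   | inj₂ x∈B′ = ⊥-elim (proj₂ (proj₂ B-basis) x (proj₁ B′-basis x∈B′) (λ x∈B → x∉IB (q⊆p∪q I B x∈B))
                       (indep-down N (∪-monoʳ ⁅ x ⁆ (q⊆p∪q I B)) xIB-ind))

contraction : Matroid n → Subset n → Matroid n
contraction N F = record
  { sys = contract (sys N) F
  ; indep? = cindep?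
  ; indep⊆E = proj₁
  ; indep-∅ = (λ x∈⊥ → ⊥-elim (∉⊥ x∈⊥)) , basis F , basis-isBasisOf F ,
              indep-down N (∪-least (λ x∈⊥ → ⊥-elim (∉⊥ x∈⊥)) ⊆-refl) (basis-indep F)
  ; indep-down = λ I⊆J (J⊆ , B , B-basis , JB-ind) →
      ⊆-trans I⊆J J⊆ , B , B-basis , indep-down N (∪-monoˡ B I⊆J) JB-ind
  ; indep-aug = cindep-aug
  }
  where
  open Rank N
  open Contraction N F

rk-contraction : ∀ (N : Matroid n) F W → Rank.rk (contraction N F) W + Rank.rk N F ≡ Rank.rk N (W ∪ F)
rk-contraction N F W = ≤-antisym ≤rk ≥rk
  where
  open Rank N
  open Contraction N F
  module C = Rank (contraction N F)
  B = basis F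
  B-basis = basis-isBasisOf F

  ≤rk : C.rk W + rk F ≤ rk (W ∪ F)
  ≤rk with C.basis-isBasisOf W
  ... | J⊆W , (J⊆ , B′ , B′-basis , JB′-ind) , _ = begin
    C.rk W + rk F       ≡⟨ cong (C.rk W +_) (∣basis∣≡rk B′-basis) ⟨
    ∣ C.basis W ∣ + ∣ B′ ∣ ≡⟨ ∣∣-∪-basis J⊆ (proj₁ B′-basis) ⟨
    ∣ C.basis W ∪ B′ ∣  ≡⟨ indep⇒rk≡∣∣ JB′-ind ⟨
    rk (C.basis W ∪ B′) ≤⟨ rk-mono (∪-least (λ x∈ → p⊆p∪q F (J⊆W x∈)) (λ x∈ → q⊆p∪q W F (proj₁ B′-basis x∈))) ⟩
    rk (W ∪ F)          ∎
    where open ≤-Reasoning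

  K = extend (W ∪ F) B
  K-basis : IsBasisOf S (W ∪ F) K
  K-basis = extend-isBasisOf (basis-indep F) (⊆-trans (basis⊆ F) (q⊆p∪q W F))
  K-ind = proj₁ (proj₂ K-basis)
  I = K ∩ ∁ F

  I⊆W : I ⊆ W
  I⊆W {x} x∈ with x∈p∩q⁻ K (∁ F) x∈
  ... | x∈K , x∈∁F with x∈p∪q⁻ W F (proj₁ K-basis x∈K)
  ...   | inj₁ x∈W = x∈W
  ...   | inj₂ x∈F = ⊥-elim (x∈∁p⇒x∉p x∈∁F x∈F)

  I-cindep : C.Ind I
  I-cindep = (λ x∈ → let (x∈K , x∈∁F) = x∈p∩q⁻ K (∁ F) x∈ in x∈p∩q⁺ (indep⊆E N K-ind x∈K , x∈∁F)) ,
             B , B-basis , indep-down N (∪-least (p∩q⊆p K (∁ F)) (⊆-extend (W ∪ F) B)) K-ind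

  K⊆I∪B : K ⊆ I ∪ B
  K⊆I∪B {x} x∈K with x ∈? F | x ∈? B
  ... | no x∉F | _ = p⊆p∪q B (x∈p∩q⁺ (x∈K , x∉p⇒x∈∁p x∉F))
  ... | yes _ | yes x∈B = q⊆p∪q I B x∈B
  ... | yes x∈F | no x∉B = ⊥-elim (proj₂ (proj₂ B-basis) x x∈F x∉B
                             (indep-down N (∪-least (⁅x⁆⊆ x∈K) (⊆-extend (W ∪ F) B)) K-ind))

  ≥rk : rk (W ∪ F) ≤ C.rk W + rk F
  ≥rk = begin
    rk (W ∪ F)    ≡⟨ ∣basis∣≡rk K-basis ⟨
    ∣ K ∣          ≤⟨ p⊆q⇒∣p∣≤∣q∣ K⊆I∪B ⟩
    ∣ I ∪ B ∣      ≤⟨ ∣p∪q∣≤∣p∣+∣q∣ I B ⟩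
    ∣ I ∣ + ∣ B ∣  ≤⟨ +-monoˡ-≤ ∣ B ∣ (C.∣indep∣≤rk I-cindep I⊆W) ⟩
    C.rk W + rk F ∎
    where open ≤-Reasoning

rk-contraction-∩∁ : ∀ (N : Matroid n) F Y → Rank.rk (contraction N F) (Y ∩ ∁ F) + Rank.rk N F ≡ Rank.rk N (Y ∪ F)
rk-contraction-∩∁ N F Y = trans (rk-contraction N F (Y ∩ ∁ F))
  (cong (Rank.rk N) (⊆-antisym (∪-monoˡ F (p∩q⊆p Y _)) (∪-least (p⊆p∩∁q∪q Y F) (q⊆p∪q _ F))))

contraction-loopless : ∀ (N : Matroid n) F → IsFlat (sys N) F → Loopless (contract (sys N) F)
contraction-loopless N F (_ , rkF<) x x∈ =
  ⁅x⁆⊆ x∈ , basis F , basis-isBasisOf F ,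
  unspanned⇒indep-⁅x⁆∪ (basis-indep F) (unspanned-antitone (basis⊆ F)
    (rkF< x (p∩q⊆p _ _ x∈) (x∈∁p⇒x∉p (p∩q⊆q _ _ x∈)) _ _ (rk-hasRankOf F) (rk-hasRankOf (⁅ x ⁆ ∪ F))))
  where open Rank N

restriction-loopless : ∀ (N : Matroid n) F → Loopless (sys N) → Loopless (restrict (sys N) F)
restriction-loopless N F loopless x x∈ = loopless x (p∩q⊆p _ _ x∈) , ⁅x⁆⊆ (p∩q⊆q _ _ x∈)

-- Circuits

module Circuits (N : Matroid n) where
  open Rank N

  dependent⇒⊇circuit : ∀ D → D ⊆ E → ¬ Ind D → ∃ λ C → C ⊆ D × IsCircuit S C
  dependent⇒⊇circuit D = go ∣ D ∣ D ≤-refl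
    where
    go : ∀ m D → ∣ D ∣ ≤ m → D ⊆ E → ¬ Ind D → ∃ λ C → C ⊆ D × IsCircuit S C
    go m D ∣D∣≤m D⊆E D-dep with any? (λ x → (x ∈? D) ×-dec ¬? (indep? N (D ∩ ∁ ⁅ x ⁆)))
    ... | no none = D , ⊆-refl , D⊆E , D-dep , minimal
      where
      minimal : ∀ C → C ⊆ D → ¬ Ind C → D ⊆ C
      minimal C C⊆D C-dep {y} y∈D with y ∈? C | indep? N (D ∩ ∁ ⁅ y ⁆)
      ... | yes y∈C | _ = y∈C
      ... | no _ | no Dy-dep = ⊥-elim (none (y , y∈D , Dy-dep))
      ... | no y∉C | yes Dy-ind = ⊥-elim (C-dep (indep-down N C⊆ Dy-ind))
        where
        C⊆ : C ⊆ D ∩ ∁ ⁅ y ⁆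
        C⊆ {z} z∈C = x∈p∩q⁺ (C⊆D z∈C , x∉p⇒x∈∁p λ z∈⁅y⁆ → y∉C (subst (_∈ C) (x∈⁅y⁆⇒x≡y y z∈⁅y⁆) z∈C))
    ... | yes (x , x∈D , Dx-dep) with m
    ...   | zero = ⊥-elim (n≮0 (<-≤-trans (x∈p⇒∣p∩∁⁅x⁆∣<∣p∣ x∈D) ∣D∣≤m))
    ...   | suc m′ =
      let (C , C⊆ , C-circuit) = go m′ (D ∩ ∁ ⁅ x ⁆) (s≤s⁻¹ (<-≤-trans (x∈p⇒∣p∩∁⁅x⁆∣<∣p∣ x∈D) ∣D∣≤m))
                                    (⊆-trans (p∩q⊆p D _) D⊆E) Dx-dep
      in C , ⊆-trans C⊆ (p∩q⊆p D _) , C-circuit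

  circuit-element-spanned : ∀ {C z} → IsCircuit S C → z ∈ C → rk (⁅ z ⁆ ∪ (C ∩ ∁ ⁅ z ⁆)) ≤ rk (C ∩ ∁ ⁅ z ⁆)
  circuit-element-spanned {C} {z} (_ , C-dep , C-min) z∈C = s≤s⁻¹ (begin-strict
    rk (⁅ z ⁆ ∪ (C ∩ ∁ ⁅ z ⁆))  ≡⟨ cong rk (⁅x⁆∪p∩∁⁅x⁆≡p z∈C) ⟩
    rk C                      <⟨ dep⇒rk<∣∣ C-dep ⟩
    ∣ C ∣                      ≡⟨ cong ∣_∣ (⁅x⁆∪p∩∁⁅x⁆≡p z∈C) ⟨
    ∣ ⁅ z ⁆ ∪ (C ∩ ∁ ⁅ z ⁆) ∣   ≡⟨ ∣⁅x⁆∪p∣≡1+∣p∣ (x∉p∩∁⁅x⁆ {x = z} {C}) ⟩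
    suc ∣ C ∩ ∁ ⁅ z ⁆ ∣         ≡⟨ cong suc (indep⇒rk≡∣∣ Cz-ind) ⟨
    suc (rk (C ∩ ∁ ⁅ z ⁆))     ∎)
    where
    open ≤-Reasoning
    Cz-ind : Ind (C ∩ ∁ ⁅ z ⁆)
    Cz-ind = decidable-stable (indep? N _) λ Cz-dep → x∉p∩∁⁅x⁆ (C-min _ (p∩q⊆p C _) Cz-dep z∈C)

module CircuitSplit (N : Matroid n) (F : Subset n) where
  open Rank N
  module C = Rank (contraction N F)

  circuit⇒contraction-dependent : ∀ {C z} → IsCircuit S C → z ∈ C → z ∉ F → ¬ C.Ind (C ∩ ∁ F)
  circuit⇒contraction-dependent {C} {z} C-circuit z∈C z∉F D-cindep = 1+n≰n (begin
    suc ∣ Dz ∣ + rk F      ≡⟨ cong (_+ rk F) ∣D∣≡1+∣Dz∣ ⟨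
    ∣ D ∣ + rk F           ≡⟨ cong (_+ rk F) (C.indep⇒rk≡∣∣ D-cindep) ⟨
    C.rk D + rk F          ≡⟨ rk-contraction N F D ⟩
    rk (D ∪ F)             ≤⟨ rk-mono D∪F⊆ ⟩
    rk (⁅ z ⁆ ∪ (Cz ∪ F))   ≤⟨ spanned-mono (p⊆p∪q F) z-spanned ⟩
    rk (Cz ∪ F)            ≤⟨ rk-mono Cz∪F⊆ ⟩
    rk (Dz ∪ F)            ≤⟨ rk-∪≤ Dz F ⟩
    rk Dz + rk F           ≤⟨ +-monoˡ-≤ (rk F) (rk≤∣∣ Dz) ⟩
    ∣ Dz ∣ + rk F          ∎)
    where
    open ≤-Reasoning
    D = C ∩ ∁ F
    Cz = C ∩ ∁ ⁅ z ⁆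
    Dz = D ∩ ∁ ⁅ z ⁆
    ∣D∣≡1+∣Dz∣ : ∣ D ∣ ≡ suc ∣ Dz ∣
    ∣D∣≡1+∣Dz∣ = trans (cong ∣_∣ (sym (⁅x⁆∪p∩∁⁅x⁆≡p (x∈p∩q⁺ (z∈C , x∉p⇒x∈∁p z∉F)))))
                       (∣⁅x⁆∪p∣≡1+∣p∣ (x∉p∩∁⁅x⁆ {x = z} {D}))
    z-spanned : rk (⁅ z ⁆ ∪ Cz) ≤ rk Cz
    z-spanned = Circuits.circuit-element-spanned N C-circuit z∈C
    D∪F⊆ : D ∪ F ⊆ ⁅ z ⁆ ∪ (Cz ∪ F)
    D∪F⊆ = ⊆-trans (∪-monoˡ F (⊆-trans (p∩q⊆p C _) (⊆-reflexive (sym (⁅x⁆∪p∩∁⁅x⁆≡p z∈C)))))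
                    (⊆-reflexive (∪-assoc ⁅ z ⁆ Cz F))
    Cz∪F⊆ : Cz ∪ F ⊆ Dz ∪ F
    Cz∪F⊆ = ∪-least (⊆-trans (p⊆p∩∁q∪q Cz F) (∪-monoˡ F (⊆-reflexive
      (trans (∩-assoc C _ _) (trans (cong (C ∩_) (∩-comm (∁ ⁅ z ⁆) (∁ F))) (sym (∩-assoc C _ _))))))) (q⊆p∪q Dz F)

  circuit-restriction⊎contraction : ∀ {C} → IsCircuit S C →
    IsCircuit (restrict S F) C ⊎ ∃ λ C′ → C′ ⊆ C × IsCircuit (contract S F) C′
  circuit-restriction⊎contraction {C} C-circuit@(C⊆E , C-dep , C-min) with C ⊆? F
  ... | yes C⊆F = inj₁ (∩-greatest C⊆E C⊆F , (λ (C-ind , _) → C-dep C-ind) ,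
                        λ C′ C′⊆C C′-dep → C-min C′ C′⊆C λ C′-ind → C′-dep (C′-ind , ⊆-trans C′⊆C C⊆F))
  ... | no C⊈F with any? (λ z → (z ∈? C) ×-dec ¬? (z ∈? F))
  ...   | no none = ⊥-elim (C⊈F λ {z} z∈C → decidable-stable (z ∈? F) λ z∉F → none (z , z∈C , z∉F))
  ...   | yes (z , z∈C , z∉F) =
    let (C′ , C′⊆ , C′-circuit) = Circuits.dependent⇒⊇circuit (contraction N F) (C ∩ ∁ F)
                                    (∩-greatest (⊆-trans (p∩q⊆p C _) C⊆E) (p∩q⊆q C _))
                                    (circuit⇒contraction-dependent C-circuit z∈C z∉F)
    in inj₂ (C′ , ⊆-trans C′⊆ (p∩q⊆p C _) , C′-circuit)

-- Colourings, cuts and standard colourings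

HasRepeatedColour : ∀ {A : Set} → (Fin n → A) → Subset n → Set
HasRepeatedColour c C = ∃ λ x → ∃ λ y → x ∈ C × y ∈ C × x ≢ y × c x ≡ c y

RepeatsOnCircuits : ∀ {A : Set} → IndepSystem n → (Fin n → A) → Set
RepeatsOnCircuits S c = ∀ C → IsCircuit S C → HasRepeatedColour c C

RepeatsOnCircuits-map : ∀ {A B : Set} {S : IndepSystem n} {c : Fin n → A} {d : Fin n → B} →
  (∀ {x y} → x ∈ ground S → y ∈ ground S → c x ≡ c y → d x ≡ d y) → RepeatsOnCircuits S c → RepeatsOnCircuits S d
RepeatsOnCircuits-map same c-repeats C C-circuit with c-repeats C C-circuit
... | x , y , x∈C , y∈C , x≢y , cx≡cy =
  x , y , x∈C , y∈C , x≢y , same (proj₁ C-circuit x∈C) (proj₁ C-circuit y∈C) cx≡cy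

maximum-in : ∀ (c : Fin n → ℕ) {C y₀} → y₀ ∈ C → ∃ λ y → y ∈ C × (∀ z → z ∈ C → c z ≤ c y)
maximum-in {n} c {C} {y₀} y₀∈C =
  y , y∈C , λ z z∈C → lookup (f[xs]≤f[argmax] y₀ xs) (∈-filter⁺ (_∈? C) (∈-allFin z) z∈C)
  where
  xs = filter (_∈? C) (allFin n)
  y = argmax c y₀ xs
  y∈C : y ∈ C
  y∈C with argmax-sel c y₀ xs
  ... | inj₁ y≡y₀ = subst (_∈ C) (sym y≡y₀) y₀∈C
  ... | inj₂ y∈xs = proj₂ (∈-filter⁻ (_∈? C) {xs = allFin n} y∈xs)

module Colourings (N : Matroid n) where
  open Rank N

  LowerColoursDoNotSpan : (Fin n → ℕ) → Set
  LowerColoursDoNotSpan c = ∀ x → x ∈ E → ∀ A → A ⊆ E → (∀ y → y ∈ A → c y < c x) → rk A < rk (⁅ x ⁆ ∪ A)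

  -- in a circuit, an element of maximal colour is spanned by the others, so its colour repeats
  lowerColoursDoNotSpan⇒repeatsOnCircuits : ∀ c → LowerColoursDoNotSpan c → RepeatsOnCircuits S c
  lowerColoursDoNotSpan⇒repeatsOnCircuits c unspanned C C-circuit@(C⊆E , C-dep , _) with nonempty? C
  ... | no C-empty = ⊥-elim (C-dep (subst Ind (sym (Empty-unique C-empty)) (indep-∅ N)))
  ... | yes (y₀ , y₀∈C) with maximum-in c y₀∈C
  ...   | y , y∈C , c≤cy with any? (λ z → (z ∈? C) ×-dec (¬? (z ≟F y) ×-dec (c z ≟ c y)))
  ...     | yes (z , z∈C , z≢y , cz≡cy) = z , y , z∈C , y∈C , z≢y , cz≡cy
  ...     | no none = ⊥-elim (<⇒≱ y-unspanned y-spanned)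
    where
    A = C ∩ ∁ ⁅ y ⁆
    lower : ∀ a → a ∈ A → c a < c y
    lower a a∈A = let (a∈C , a∉⁅y⁆) = x∈p∩q⁻ C _ a∈A in ≤∧≢⇒< (c≤cy a a∈C) λ ca≡cy →
      none (a , a∈C , (λ a≡y → x∈∁p⇒x∉p a∉⁅y⁆ (subst (_∈ ⁅ y ⁆) (sym a≡y) (x∈⁅x⁆ y))) , ca≡cy)
    y-unspanned : rk A < rk (⁅ y ⁆ ∪ A)
    y-unspanned = unspanned y (C⊆E y∈C) A (⊆-trans (p∩q⊆p C _) C⊆E) lower
    y-spanned : rk (⁅ y ⁆ ∪ A) ≤ rk A
    y-spanned = Circuits.circuit-element-spanned N C-circuit y∈C

module Cuts (N : Matroid n) where
  open Rank N

  isBasis-restrict⇒isBasisOf : ∀ {W B} → IsBasis (restrict S W) B → IsBasisOf S (E ∩ W) B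
  isBasis-restrict⇒isBasisOf (B⊆ , (B-ind , B⊆W) , B-max) =
    B⊆ , B-ind , λ x x∈ x∉B xB-ind → B-max x x∈ x∉B (xB-ind , ∪-least (⁅x⁆⊆ (p∩q⊆q _ _ x∈)) B⊆W)

  isBasisOf⇒isBasis-restrict : ∀ {W B} → IsBasisOf S (E ∩ W) B → IsBasis (restrict S W) B
  isBasisOf⇒isBasis-restrict (B⊆ , B-ind , B-max) =
    B⊆ , (B-ind , ⊆-trans B⊆ (p∩q⊆q _ _)) , λ x x∈ x∉B (xB-ind , _) → B-max x x∈ x∉B xB-ind

  -- otherwise x is spanned by the complement of T, and T minus x would still meet every basis
  cut-unspanned : ∀ {W T x A} → IsCut (restrict S W) T → x ∈ T → A ⊆ E ∩ W → (∀ y → y ∈ A → y ∉ T) →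
                  rk A < rk (⁅ x ⁆ ∪ A)
  cut-unspanned {W} {T} {x} {A} (_ , T-meets , T-min) x∈T A⊆ A∩T-empty with rk A <? rk (⁅ x ⁆ ∪ A)
  ... | yes unspanned = unspanned
  ... | no spanned = ⊥-elim (x∉T′ (T-min T′ (p∩q⊆p T _) T′-meets x∈T))
    where
    W′ = (E ∩ W) ∩ ∁ T
    T′ = T ∩ ∁ ⁅ x ⁆
    x∉T′ : x ∉ T′
    x∉T′ = x∉p∩∁⁅x⁆
    x-spanned : rk (⁅ x ⁆ ∪ W′) ≤ rk W′
    x-spanned = spanned-mono (λ a∈ → x∈p∩q⁺ (A⊆ a∈ , x∉p⇒x∈∁p (A∩T-empty _ a∈))) (≮⇒≥ spanned)
    T′-meets : MeetsEveryBasis (restrict S W) T′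
    T′-meets B B-basis with nonempty? (T′ ∩ B)
    ... | yes T′∩B-nonempty = T′∩B-nonempty
    ... | no T′∩B-empty = ⊥-elim (D∩T-empty (T-meets D (isBasisOf⇒isBasis-restrict D-basis)))
      where
      B⊆ : B ⊆ ⁅ x ⁆ ∪ W′
      B⊆ {b} b∈B with b ∈? T | b ≟F x
      ... | no b∉T | _ = q⊆p∪q _ _ (x∈p∩q⁺ (proj₁ B-basis b∈B , x∉p⇒x∈∁p b∉T))
      ... | yes _ | yes refl = p⊆p∪q W′ (x∈⁅x⁆ x)
      ... | yes b∈T | no b≢x = ⊥-elim (T′∩B-empty (b , x∈p∩q⁺ (x∈p∩q⁺ (b∈T , x∉p⇒x∈∁p (x≢y⇒x∉⁅y⁆ b≢x)) , b∈B)))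
      D = basis W′
      D-basis : IsBasisOf S (E ∩ W) D
      D-basis = indep-⊆-∧-rk≤⇒isBasisOf (⊆-trans (basis⊆ W′) (p∩q⊆p _ _)) (basis-indep W′) (begin
        rk (E ∩ W)       ≡⟨ ∣basis∣≡rk (isBasis-restrict⇒isBasisOf B-basis) ⟨
        ∣ B ∣             ≤⟨ ∣indep∣≤rk (proj₁ (proj₂ (isBasis-restrict⇒isBasisOf B-basis))) B⊆ ⟩
        rk (⁅ x ⁆ ∪ W′)   ≤⟨ x-spanned ⟩
        rk W′            ∎)
        where open ≤-Reasoning
      D∩T-empty : Empty (T ∩ D)
      D∩T-empty (z , z∈) = let (z∈T , z∈D) = x∈p∩q⁻ T D z∈ in x∈∁p⇒x∉p (p∩q⊆q _ _ (basis⊆ W′ z∈D)) z∈T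

  hyperplane-complement-isCut : ∀ {W W′ T} → T ⊆ E ∩ W → W′ ⊆ E ∩ W → (∀ x → x ∈ T → x ∉ W′) →
    E ∩ W ⊆ W′ ∪ T → rk (E ∩ W) ≡ suc (rk W′) → (∀ x → x ∈ T → rk W′ < rk (⁅ x ⁆ ∪ W′)) →
    IsCut (restrict S W) T
  hyperplane-complement-isCut {W} {W′} {T} T⊆ W′⊆ T∩W′-empty ⊆W′∪T rk≡ T-unspanned = T⊆ , T-meets , T-min
    where
    T-meets : MeetsEveryBasis (restrict S W) T
    T-meets B B-basis with nonempty? (T ∩ B)
    ... | yes T∩B-nonempty = T∩B-nonempty
    ... | no T∩B-empty = ⊥-elim (1+n≰n (begin
      suc (rk W′)   ≡⟨ rk≡ ⟨
      rk (E ∩ W)    ≡⟨ ∣basis∣≡rk (isBasis-restrict⇒isBasisOf B-basis) ⟨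
      ∣ B ∣          ≤⟨ ∣indep∣≤rk (proj₁ (proj₂ (isBasis-restrict⇒isBasisOf B-basis))) B⊆W′ ⟩
      rk W′         ∎))
      where
      open ≤-Reasoning
      B⊆W′ : B ⊆ W′
      B⊆W′ {b} b∈B with x∈p∪q⁻ W′ T (⊆W′∪T (proj₁ B-basis b∈B))
      ... | inj₁ b∈W′ = b∈W′
      ... | inj₂ b∈T = ⊥-elim (T∩B-empty (b , x∈p∩q⁺ (b∈T , b∈B)))
    T-min : ∀ K → K ⊆ T → MeetsEveryBasis (restrict S W) K → T ⊆ K
    T-min K K⊆T K-meets {x} x∈T =
      decidable-stable (x ∈? K) λ x∉K → K∩C-empty x∉K (K-meets C (isBasisOf⇒isBasis-restrict C-basis))
      where
      D = basis W′
      x∉D : x ∉ D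
      x∉D x∈D = T∩W′-empty x x∈T (basis⊆ W′ x∈D)
      C = ⁅ x ⁆ ∪ D
      C-basis : IsBasisOf S (E ∩ W) C
      C-basis = indep-⊆-∧-rk≤⇒isBasisOf (∪-least (⁅x⁆⊆ (T⊆ x∈T)) (⊆-trans (basis⊆ W′) W′⊆))
        (unspanned⇒indep-⁅x⁆∪ (basis-indep W′) (unspanned-antitone (basis⊆ W′) (T-unspanned x x∈T)))
        (≤-reflexive (trans rk≡ (sym (∣⁅x⁆∪p∣≡1+∣p∣ x∉D))))
      K∩C-empty : x ∉ K → Empty (K ∩ C)
      K∩C-empty x∉K (z , z∈) with x∈p∩q⁻ K C z∈
      ... | z∈K , z∈C with x∈p∪q⁻ ⁅ x ⁆ D z∈C
      ...   | inj₁ z∈⁅x⁆ = x∉K (subst (_∈ K) (x∈⁅y⁆⇒x≡y x z∈⁅x⁆) z∈K)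
      ...   | inj₂ z∈D = T∩W′-empty z (K⊆T z∈K) (basis⊆ W′ z∈D)

  standard⇒lowerColoursDoNotSpan : ∀ {k} (c : Fin n → Fin k) (c-standard : IsStandard S c) →
    Colourings.LowerColoursDoNotSpan N (λ x → toℕ (proj₁ c-standard ⟨$⟩ˡ c x))
  standard⇒lowerColoursDoNotSpan c (σ , cuts) x x∈E A A⊆E lower = cut-unspanned (cuts i) x∈T A⊆ A∩T-empty
    where
    i = σ ⟨$⟩ˡ c x
    x∈T : x ∈ colourClass S c (σ ⟨$⟩ʳ i)
    x∈T = x∈p∩q⁺ (x∈E , ∈-select⁺ (λ y → c y ≟F σ ⟨$⟩ʳ i) (sym (inverseʳ σ)))
    A⊆ : A ⊆ E ∩ (E ∩ tabulate (λ y → ⌊ σ ⟨$⟩ˡ c y ≤?F i ⌋))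
    A⊆ {y} y∈A = x∈p∩q⁺ (A⊆E y∈A , x∈p∩q⁺ (A⊆E y∈A , ∈-select⁺ (λ z → σ ⟨$⟩ˡ c z ≤?F i) (<⇒≤ (lower y y∈A))))
    A∩T-empty : ∀ y → y ∈ A → y ∉ colourClass S c (σ ⟨$⟩ʳ i)
    A∩T-empty y y∈A y∈T = <-irrefl (cong toℕ (trans (cong (σ ⟨$⟩ˡ_) cy≡) (inverseˡ σ))) (lower y y∈A)
      where
      cy≡ : c y ≡ σ ⟨$⟩ʳ i
      cy≡ = ∈-select⁻ (λ z → c z ≟F σ ⟨$⟩ʳ i) (p∩q⊆q _ _ y∈T)

injective⇒surjective : ∀ {k} (g : Fin k → Fin k) → (∀ {a b} → g a ≡ g b → a ≡ b) → ∀ i → ∃ λ j → g j ≡ i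
injective⇒surjective {suc k} g g-inj i with any? (λ j → g j ≟F i)
... | yes hit = hit
... | no miss = ⊥-elim (1+n≰n (injective⇒≤ {f = h} h-inj))
  where
  h : Fin (suc k) → Fin k
  h j = punchOut {i = i} {j = g j} (λ i≡gj → miss (j , sym i≡gj))
  h-inj : ∀ {a b} → h a ≡ h b → a ≡ b
  h-inj {a} {b} ha≡hb = g-inj (punchOut-injective (λ e → miss (a , sym e)) (λ e → miss (b , sym e)) ha≡hb)

module StandardFromOrder {k} (S : IndepSystem n) (c : Fin n → Fin k)
                         (f : Fin k → ℕ) (f-inj : ∀ {a b} → f a ≡ f b → a ≡ b) where

  below : Fin k → Subset k
  below j = tabulate (λ j′ → ⌊ f j′ <? f j ⌋)

  ∣below∣<k : ∀ j → ∣ below j ∣ < k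
  ∣below∣<k j = subst (∣ below j ∣ <_) (∣⊤∣≡n k)
    (p⊂q⇒∣p∣<∣q∣ (⊆⊤ , j , ∈⊤ , λ j∈ → <-irrefl refl (∈-select⁻ (λ j′ → f j′ <? f j) j∈)))

  below-mono : ∀ {a b} → f a ≤ f b → below a ⊆ below b
  below-mono fa≤fb j∈ = ∈-select⁺ (λ j′ → _ <? _) (<-≤-trans (∈-select⁻ (λ j′ → _ <? _) j∈) fa≤fb)

  below-strict : ∀ {a b} → f a < f b → ∣ below a ∣ < ∣ below b ∣
  below-strict {a} fa<fb = p⊂q⇒∣p∣<∣q∣ (below-mono (<⇒≤ fa<fb) , a , ∈-select⁺ (λ j′ → _ <? _) fa<fb ,
                                         λ a∈ → <-irrefl refl (∈-select⁻ (λ j′ → _ <? _) a∈))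

  ∣below∣-reflects-≤ : ∀ {a b} → ∣ below a ∣ ≤ ∣ below b ∣ → f a ≤ f b
  ∣below∣-reflects-≤ ∣a∣≤∣b∣ = ≮⇒≥ λ fb<fa → <⇒≱ (below-strict fb<fa) ∣a∣≤∣b∣

  position : Fin k → Fin k
  position j = fromℕ< (∣below∣<k j)

  toℕ-position : ∀ j → toℕ (position j) ≡ ∣ below j ∣
  toℕ-position j = toℕ-fromℕ< (∣below∣<k j)

  position-≤ : ∀ {a b} → position a ≤F position b ⇔ f a ≤ f b
  position-≤ {a} {b} = mk⇔
    (λ pa≤pb → ∣below∣-reflects-≤ (subst₂ _≤_ (toℕ-position a) (toℕ-position b) pa≤pb))
    (λ fa≤fb → subst₂ _≤_ (sym (toℕ-position a)) (sym (toℕ-position b)) (p⊆q⇒∣p∣≤∣q∣ (below-mono fa≤fb)))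

  position-injective : ∀ {a b} → position a ≡ position b → a ≡ b
  position-injective pa≡pb = f-inj (≤-antisym (Equivalence.to position-≤ (≤-reflexive (cong toℕ pa≡pb)))
                                               (Equivalence.to position-≤ (≤-reflexive (cong toℕ (sym pa≡pb)))))

  colourAt : Fin k → Fin k
  colourAt i = proj₁ (injective⇒surjective position position-injective i)

  position-colourAt : ∀ i → position (colourAt i) ≡ i
  position-colourAt i = proj₂ (injective⇒surjective position position-injective i)

  position≤⇔ : ∀ j i → position j ≤F i ⇔ f j ≤ f (colourAt i)
  position≤⇔ j i = subst (λ i′ → position j ≤F i′ ⇔ f j ≤ f (colourAt i)) (position-colourAt i) position-≤

  order : Permutation′ k
  order = permutation colourAt position (λ j → position-injective (position-colourAt (position j))) position-colourAt

  standard-from-order :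
    (∀ j → IsCut (restrict S (ground S ∩ tabulate (λ x → ⌊ f (c x) ≤? f j ⌋))) (colourClass S c j)) → IsStandard S c
  standard-from-order cuts = order , λ i →
    subst (λ W → IsCut (restrict S (ground S ∩ W)) (colourClass S c (colourAt i))) (sym (same-classes i))
          (cuts (colourAt i))
    where
    same-classes : ∀ i → tabulate (λ x → ⌊ position (c x) ≤?F i ⌋) ≡ tabulate (λ x → ⌊ f (c x) ≤? f (colourAt i) ⌋)
    same-classes i = ⊆-antisym
      (λ x∈ → ∈-select⁺ (λ x → f (c x) ≤? f (colourAt i))
                (Equivalence.to (position≤⇔ (c _) i) (∈-select⁻ (λ x → position (c x) ≤?F i) x∈)))
      (λ x∈ → ∈-select⁺ (λ x → position (c x) ≤?F i)
                (Equivalence.from (position≤⇔ (c _) i) (∈-select⁻ (λ x → f (c x) ≤? f (colourAt i)) x∈)))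

-- Flag colourings of loopless matroids

least : ∀ {ℓ} {P : ℕ → Set ℓ} → Decidable P → ℕ → ℕ
least P? zero = zero
least P? (suc b) with P? zero
... | yes _ = zero
... | no _ = suc (least (λ t → P? (suc t)) b)

least-satisfies : ∀ {ℓ} {P : ℕ → Set ℓ} (P? : Decidable P) {b t} → t < b → P t → P (least P? b)
least-satisfies P? {suc b} {t} t<b Pt with P? zero | t
... | yes P0 | _ = P0
... | no ¬P0 | zero = ⊥-elim (¬P0 Pt)
... | no _ | suc t′ = least-satisfies (λ t → P? (suc t)) (s<s⁻¹ t<b) Pt

least-minimal : ∀ {ℓ} {P : ℕ → Set ℓ} (P? : Decidable P) b {u} → u < least P? b → ¬ P u
least-minimal P? (suc b) {u} u<least with P? zero | u
... | no ¬P0 | zero = ¬P0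
... | no _ | suc u′ = least-minimal (λ t → P? (suc t)) b (s<s⁻¹ u<least)

least-unique : ∀ {ℓ} {P : ℕ → Set ℓ} (P? : Decidable P) {b t} → t < b → P t → (∀ u → u < t → ¬ P u) → least P? b ≡ t
least-unique P? {b} {t} t<b Pt below-t with <-cmp (least P? b) t
... | tri< least<t _ _ = ⊥-elim (below-t _ least<t (least-satisfies P? t<b Pt))
... | tri≈ _ least≡t _ = least≡t
... | tri> _ _ t<least = ⊥-elim (least-minimal P? b t<least Pt)

intermediate-value : ∀ (g : ℕ → ℕ) {j} m → g 0 ≤ j → j < g m → (∀ t → g (suc t) ≤ suc (g t)) →
                     ∃ λ t → t < m × g t ≡ j × g (suc t) ≡ suc j
intermediate-value g zero g0≤j j<g0 _ = ⊥-elim (<⇒≱ j<g0 g0≤j)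
intermediate-value g {j} (suc m) g0≤j j<gm+1 step with j <? g m
... | yes j<gm = let (t , t<m , gt≡j , gt+1≡j+1) = intermediate-value g m g0≤j j<gm step in
                 t , m<n⇒m<1+n t<m , gt≡j , gt+1≡j+1
... | no j≮gm = m , ≤-refl , ≤-antisym gm≤j (s≤s⁻¹ (≤-trans j<gm+1 (step m))) ,
                ≤-antisym (≤-trans (step m) (s≤s gm≤j)) j<gm+1
  where
  gm≤j = ≮⇒≥ j≮gm

module Flag (N : Matroid n) (loopless : Loopless (sys N)) where
  open Rank N
  open Colourings N

  initial : ℕ → Subset n
  initial t = E ∩ tabulate (λ y → ⌊ toℕ y <? t ⌋)

  initial-mono : ∀ {t t′} → t ≤ t′ → initial t ⊆ initial t′
  initial-mono t≤t′ y∈ = let (y∈E , y<t) = x∈p∩q⁻ E _ y∈ in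
    x∈p∩q⁺ (y∈E , ∈-select⁺ (λ z → toℕ z <? _) (<-≤-trans (∈-select⁻ (λ z → toℕ z <? _) y<t) t≤t′))

  initial-suc⁻ : ∀ {t z} → z ∈ initial (suc t) → z ∈ initial t ⊎ toℕ z ≡ t
  initial-suc⁻ {t} {z} z∈ with x∈p∩q⁻ E _ z∈
  ... | z∈E , z<t+1 with m≤n⇒m<n∨m≡n (s≤s⁻¹ (∈-select⁻ (λ z → toℕ z <? suc t) z<t+1))
  ...   | inj₁ z<t = inj₁ (x∈p∩q⁺ (z∈E , ∈-select⁺ (λ z → toℕ z <? t) z<t))
  ...   | inj₂ z≡t = inj₂ z≡t

  initial-suc⊆ : ∀ t (y : Fin n) → toℕ y ≡ t → initial (suc t) ⊆ ⁅ y ⁆ ∪ initial t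
  initial-suc⊆ t y y≡t {z} z∈ with initial-suc⁻ z∈
  ... | inj₁ z∈initial = q⊆p∪q _ _ z∈initial
  ... | inj₂ z≡t = p⊆p∪q _ (subst (_∈ ⁅ y ⁆) (toℕ-injective (trans y≡t (sym z≡t))) (x∈⁅x⁆ y))

  initial-n≤t : ∀ {t} → n ≤ t → initial (suc t) ⊆ initial t
  initial-n≤t n≤t z∈ = x∈p∩q⁺ (p∩q⊆p E _ z∈ , ∈-select⁺ (λ z → toℕ z <? _) (<-≤-trans (toℕ<n _) n≤t))

  rk-initial-0 : rk (initial 0) ≡ 0
  rk-initial-0 = n≤0⇒n≡0 (≤-trans (rk≤∣∣ (initial 0)) (≤-reflexive (trans (cong ∣_∣ initial-0≡⊥) (∣⊥∣≡0 n))))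
    where
    initial-0≡⊥ : initial 0 ≡ ⊥
    initial-0≡⊥ = Empty-unique λ (y , y∈) → n≮0 (∈-select⁻ (λ z → toℕ z <? 0) (p∩q⊆q E _ y∈))

  rk-initial-suc : ∀ t → rk (initial (suc t)) ≤ suc (rk (initial t))
  rk-initial-suc t with t <? n
  ... | yes t<n = ≤-trans (rk-mono (initial-suc⊆ t (fromℕ< t<n) (toℕ-fromℕ< t<n))) (rk-⁅x⁆∪≤ _ _)
  ... | no t≮n = ≤-trans (rk-mono (initial-n≤t (≮⇒≥ t≮n))) (n≤1+n _)

  spanned? : ∀ x t → Dec (rk (⁅ x ⁆ ∪ initial (suc t)) ≤ rk (initial (suc t)))
  spanned? x t = rk (⁅ x ⁆ ∪ initial (suc t)) ≤? rk (initial (suc t))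

  -- for x ∈ E the search succeeds, at the latest at t = toℕ x
  entry : Fin n → ℕ
  entry x = least (spanned? x) n

  flag : Fin n → ℕ
  flag x = rk (initial (entry x))

  spanned-at-entry : ∀ {x} → x ∈ E → rk (⁅ x ⁆ ∪ initial (suc (entry x))) ≤ rk (initial (suc (entry x)))
  spanned-at-entry {x} x∈E = least-satisfies (spanned? x) (toℕ<n x) (≤-reflexive (cong rk (⁅x⁆∪p≡p x∈)))
    where
    x∈ : x ∈ initial (suc (toℕ x))
    x∈ = x∈p∩q⁺ (x∈E , ∈-select⁺ (λ z → toℕ z <? suc (toℕ x)) ≤-refl)

  unspanned-before-entry : ∀ {x} t → x ∈ E → t ≤ entry x → rk (initial t) < rk (⁅ x ⁆ ∪ initial t)
  unspanned-before-entry {x} zero x∈E _ = begin-strict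
    rk (initial 0)        ≡⟨ rk-initial-0 ⟩
    0                     <⟨ s≤s z≤n ⟩
    1                     ≡⟨ ∣⁅x⁆∣≡1 x ⟨
    ∣ ⁅ x ⁆ ∣              ≤⟨ ∣indep∣≤rk (loopless x x∈E) (p⊆p∪q (initial 0)) ⟩
    rk (⁅ x ⁆ ∪ initial 0) ∎
    where open ≤-Reasoning
  unspanned-before-entry {x} (suc u) _ u<entry = ≰⇒> (least-minimal (spanned? x) n u<entry)

  flag-lowerColoursDoNotSpan : LowerColoursDoNotSpan flag
  flag-lowerColoursDoNotSpan x x∈E A A⊆E lower = unspanned-antitone (q⊆p∪q I A) (begin-strict
    rk (I ∪ A)             ≡⟨ rk-∪-spanned A-spanned ⟩
    rk I                   <⟨ unspanned-before-entry (entry x) x∈E ≤-refl ⟩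
    rk (⁅ x ⁆ ∪ I)          ≤⟨ rk-mono (∪-monoʳ ⁅ x ⁆ (p⊆p∪q A)) ⟩
    rk (⁅ x ⁆ ∪ (I ∪ A))    ∎)
    where
    open ≤-Reasoning
    I = initial (entry x)
    A-spanned : ∀ a → a ∈ A → rk (⁅ a ⁆ ∪ I) ≤ rk I
    A-spanned a a∈A = spanned-mono (initial-mono entry-a<entry-x) (spanned-at-entry (A⊆E a∈A))
      where
      entry-a<entry-x : entry a < entry x
      entry-a<entry-x = ≰⇒> λ entry-x≤entry-a → <⇒≱ (lower a a∈A) (rk-mono (initial-mono entry-x≤entry-a))

  flag-repeatsOnCircuits : RepeatsOnCircuits S flag
  flag-repeatsOnCircuits = lowerColoursDoNotSpan⇒repeatsOnCircuits flag flag-lowerColoursDoNotSpan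

  flag<rk : ∀ {x} → x ∈ E → flag x < rk E
  flag<rk {x} x∈E =
    <-≤-trans (unspanned-before-entry (entry x) x∈E ≤-refl) (rk-mono (∪-least (⁅x⁆⊆ x∈E) (p∩q⊆p _ _)))

  flag-surjective : ∀ {j} → j < rk E → ∃ λ x → x ∈ E × flag x ≡ j
  flag-surjective {j} j<rk
    with intermediate-value (λ t → rk (initial t)) n (≤-trans (≤-reflexive rk-initial-0) z≤n)
           (<-≤-trans j<rk (rk-mono λ {y} y∈E → x∈p∩q⁺ (y∈E , ∈-select⁺ (λ z → toℕ z <? n) (toℕ<n y))))
           rk-initial-suc
  ... | t , t<n , rk≡j , rk-suc≡ = y , y∈E , trans (cong (rk ∘ initial) entry-y≡t) rk≡j
    where
    y = fromℕ< t<n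
    y≡t = toℕ-fromℕ< t<n
    grows : ¬ rk (initial (suc t)) ≤ rk (initial t)
    grows ≤ = 1+n≰n (subst₂ _≤_ rk-suc≡ rk≡j ≤)
    no-new-element : y ∉ E → initial (suc t) ⊆ initial t
    no-new-element y∉E z∈ with initial-suc⁻ z∈
    ... | inj₁ z∈initial = z∈initial
    ... | inj₂ z≡t = ⊥-elim (y∉E (subst (_∈ E) (toℕ-injective (trans z≡t (sym y≡t))) (p∩q⊆p E _ z∈)))
    y∈E : y ∈ E
    y∈E = decidable-stable (y ∈? E) (grows ∘ rk-mono ∘ no-new-element)
    y∈initial : y ∈ initial (suc t)
    y∈initial = x∈p∩q⁺ (y∈E , ∈-select⁺ (λ z → toℕ z <? suc t) (s≤s (≤-reflexive y≡t)))
    entry-y≡t : entry y ≡ t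
    entry-y≡t = least-unique (spanned? y) t<n (≤-reflexive (cong rk (⁅x⁆∪p≡p y∈initial))) λ u u<t spanned-u →
      grows (≤-trans (rk-mono (initial-suc⊆ t y y≡t)) (spanned-mono (initial-mono u<t) spanned-u))

-- A standard colouring of M induces standard colourings of M|F and M/F

exchange-right : ∀ a b c d → (a + b) + (c + d) ≡ (a + d) + (c + b)
exchange-right = solve 4 (λ a b c d → (a :+ b) :+ (c :+ d) := (a :+ d) :+ (c :+ b)) refl
  where open +-*-Solver

rotate : ∀ a b c → (a + b) + c ≡ (c + b) + a
rotate = solve 3 (λ a b c → (a :+ b) :+ c := (c :+ b) :+ a) refl
  where open +-*-Solver

exchange-left : ∀ a b c d → (a + b) + (c + d) ≡ (c + b) + (a + d)
exchange-left = solve 4 (λ a b c d → (a :+ b) :+ (c :+ d) := (c :+ b) :+ (a :+ d)) refl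
  where open +-*-Solver

telescope-≤ : ∀ (R a : ℕ → ℕ) {t t′} → t ≤ t′ → (∀ s → t ≤ s → s < t′ → R s + a (suc s) ≤ R (suc s) + a s) →
              R t + a t′ ≤ R t′ + a t
telescope-≤ R a {t} {zero} z≤n _ = ≤-refl
telescope-≤ R a {t} {suc t′} t≤1+t′ step with m≤n⇒m<n∨m≡n t≤1+t′
... | inj₂ refl = ≤-refl
... | inj₁ t<1+t′ = +-cancelʳ-≤ (R t′ + a t′) _ _ (begin
  (R t + a (suc t′)) + (R t′ + a t′)     ≡⟨ exchange-right (R t) (a (suc t′)) (R t′) (a t′) ⟩
  (R t + a t′) + (R t′ + a (suc t′))     ≤⟨ +-mono-≤ (telescope-≤ R a t≤t′ λ s t≤s s<t′ → step s t≤s (m<n⇒m<1+n s<t′))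
                                                    (step t′ t≤t′ ≤-refl) ⟩
  (R t′ + a t) + (R (suc t′) + a t′)     ≡⟨ exchange-left (R t′) (a t) (R (suc t′)) (a t′) ⟩
  (R (suc t′) + a t) + (R t′ + a t′)     ∎)
  where
  open ≤-Reasoning
  t≤t′ = s≤s⁻¹ t<1+t′

module StandardJoin (M : Matroid n) (F : Subset n) {k₁ k₂ : ℕ} (e : Fin n → Fin (k₁ + k₂))
  (e-colouring : IsColouring (sys M) (k₁ + k₂) e) (e-standard : IsStandard (sys M) e)
  (left⇒F : ∀ x → x ∈ ground (sys M) → toℕ (e x) < k₁ → x ∈ F)
  (rk-F : Rank.rk M F ≡ k₁) (rk-E : Rank.rk M (ground (sys M)) ≡ k₁ + k₂) where
  open Rank M

  K : ℕ
  K = k₁ + k₂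

  σ : Permutation′ K
  σ = proj₁ e-standard

  pos : Fin K → ℕ
  pos j = toℕ (σ ⟨$⟩ˡ j)

  pos-injective : ∀ {a b} → pos a ≡ pos b → a ≡ b
  pos-injective {a} {b} pa≡pb =
    trans (sym (inverseʳ σ)) (trans (cong (σ ⟨$⟩ʳ_) (toℕ-injective pa≡pb)) (inverseʳ σ))

  colourAt : ∀ {s} → s < K → Fin K
  colourAt s<K = σ ⟨$⟩ʳ fromℕ< s<K

  pos-colourAt : ∀ {s} (s<K : s < K) → pos (colourAt s<K) ≡ s
  pos-colourAt s<K = trans (cong toℕ (inverseˡ σ)) (toℕ-fromℕ< s<K)

  p : Fin n → ℕ
  p x = pos (e x)

  p-lower : Colourings.LowerColoursDoNotSpan M p
  p-lower = Cuts.standard⇒lowerColoursDoNotSpan M e e-standard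

  U : ℕ → Subset n
  U t = E ∩ tabulate (λ x → ⌊ p x <? t ⌋)

  U⁺ : ∀ {x t} → x ∈ E → p x < t → x ∈ U t
  U⁺ x∈E px<t = x∈p∩q⁺ (x∈E , ∈-select⁺ (λ y → p y <? _) px<t)

  U⊆E : ∀ {t} → U t ⊆ E
  U⊆E = p∩q⊆p _ _

  U⁻ : ∀ {x t} → x ∈ U t → p x < t
  U⁻ x∈ = ∈-select⁻ (λ y → p y <? _) (p∩q⊆q _ _ x∈)

  U-mono : ∀ {t t′} → t ≤ t′ → U t ⊆ U t′
  U-mono t≤t′ x∈ = U⁺ (U⊆E x∈) (<-≤-trans (U⁻ x∈) t≤t′)

  below : ℕ → Subset K
  below t = tabulate (λ j → ⌊ pos j <? t ⌋)

  count : Subset K → ℕ → ℕ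
  count D t = ∣ below t ∩ D ∣

  count-0 : ∀ D → count D 0 ≡ 0
  count-0 D = trans (cong ∣_∣ (Empty-unique none)) (∣⊥∣≡0 K)
    where
    none : Empty (below 0 ∩ D)
    none (j , j∈) = n≮0 (∈-select⁻ (λ j → pos j <? 0) (p∩q⊆p _ D j∈))

  count-K : ∀ D → count D K ≡ ∣ D ∣
  count-K D = cong ∣_∣ (trans (cong (_∩ D) below-K≡⊤) (∩-identityˡ D))
    where
    below-K≡⊤ : below K ≡ ⊤
    below-K≡⊤ = ⊆-antisym ⊆⊤ λ {j} _ → ∈-select⁺ (λ j → pos j <? K) (toℕ<n (σ ⟨$⟩ˡ j))

  below-suc : ∀ {j s} → pos j ≡ s → below (suc s) ≡ ⁅ j ⁆ ∪ below s
  below-suc {j} {s} pj≡s = ⊆-antisym below-suc⊆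
    (∪-least (⁅x⁆⊆ (∈-select⁺ (λ j → pos j <? suc s) (s≤s (≤-reflexive pj≡s))))
             (λ i∈ → ∈-select⁺ (λ j → pos j <? suc s) (m<n⇒m<1+n (∈-select⁻ (λ j → pos j <? s) i∈))))
    where
    below-suc⊆ : below (suc s) ⊆ ⁅ j ⁆ ∪ below s
    below-suc⊆ {i} i∈ with m≤n⇒m<n∨m≡n (s≤s⁻¹ (∈-select⁻ (λ j → pos j <? suc s) i∈))
    ... | inj₁ pi<s = q⊆p∪q _ _ (∈-select⁺ (λ j → pos j <? s) pi<s)
    ... | inj₂ pi≡s = p⊆p∪q _ (subst (_∈ ⁅ j ⁆) (pos-injective (trans pj≡s (sym pi≡s))) (x∈⁅x⁆ j))

  count-suc-∈ : ∀ {D j s} → pos j ≡ s → j ∈ D → count D (suc s) ≡ suc (count D s)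
  count-suc-∈ {D} {j} {s} pj≡s j∈D = begin
    ∣ below (suc s) ∩ D ∣            ≡⟨ cong (λ B → ∣ B ∩ D ∣) (below-suc pj≡s) ⟩
    ∣ (⁅ j ⁆ ∪ below s) ∩ D ∣        ≡⟨ cong ∣_∣ (∩-distribʳ-∪ D ⁅ j ⁆ (below s)) ⟩
    ∣ (⁅ j ⁆ ∩ D) ∪ (below s ∩ D) ∣  ≡⟨ cong (λ J → ∣ J ∪ (below s ∩ D) ∣) ⁅j⁆∩D≡⁅j⁆ ⟩
    ∣ ⁅ j ⁆ ∪ (below s ∩ D) ∣        ≡⟨ ∣⁅x⁆∪p∣≡1+∣p∣ j∉ ⟩
    suc ∣ below s ∩ D ∣              ∎
    where
    open ≡-Reasoning
    ⁅j⁆∩D≡⁅j⁆ : ⁅ j ⁆ ∩ D ≡ ⁅ j ⁆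
    ⁅j⁆∩D≡⁅j⁆ = ⊆-antisym (p∩q⊆p _ D) (∩-greatest ⊆-refl (⁅x⁆⊆ j∈D))
    j∉ : j ∉ below s ∩ D
    j∉ j∈ = <-irrefl pj≡s (∈-select⁻ (λ j → pos j <? s) (p∩q⊆p _ D j∈))

  count-suc-∉ : ∀ {D j s} → pos j ≡ s → j ∉ D → count D (suc s) ≡ count D s
  count-suc-∉ {D} {j} {s} pj≡s j∉D = begin
    ∣ below (suc s) ∩ D ∣            ≡⟨ cong (λ B → ∣ B ∩ D ∣) (below-suc pj≡s) ⟩
    ∣ (⁅ j ⁆ ∪ below s) ∩ D ∣        ≡⟨ cong ∣_∣ (∩-distribʳ-∪ D ⁅ j ⁆ (below s)) ⟩
    ∣ (⁅ j ⁆ ∩ D) ∪ (below s ∩ D) ∣  ≡⟨ cong (λ J → ∣ J ∪ (below s ∩ D) ∣) (Empty-unique ⁅j⁆∩D-empty) ⟩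
    ∣ ⊥ ∪ (below s ∩ D) ∣            ≡⟨ cong ∣_∣ (∪-identityˡ (below s ∩ D)) ⟩
    ∣ below s ∩ D ∣                  ∎
    where
    open ≡-Reasoning
    ⁅j⁆∩D-empty : Empty (⁅ j ⁆ ∩ D)
    ⁅j⁆∩D-empty (i , i∈) = let (i∈⁅j⁆ , i∈D) = x∈p∩q⁻ ⁅ j ⁆ D i∈ in
                           j∉D (subst (_∈ D) (x∈⁅y⁆⇒x≡y j i∈⁅j⁆) i∈D)

  left : Subset K
  left = tabulate (λ j → ⌊ toℕ j <? k₁ ⌋)

  count-⊤ : ∀ t → count ⊤ t ≡ count left t + count (∁ left) t
  count-⊤ t = trans (cong ∣_∣ (∩-identityʳ (below t))) (sym (∣p∩q∣+∣p∩∁q∣≡∣p∣ (below t) left))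

  -- Along the standard order, rk (Z t) goes up by one exactly at the positions of the colours in Dcol.
  module Part (D : Subset n) (Dcol : Subset K) (D-coloured : ∀ x → x ∈ E → e x ∈ Dcol → x ∈ D) where

    Z : ℕ → Subset n
    Z t = U t ∩ D

    Z-mono : ∀ {t t′} → t ≤ t′ → Z t ⊆ Z t′
    Z-mono t≤t′ x∈ = let (x∈U , x∈D) = x∈p∩q⁻ _ _ x∈ in x∈p∩q⁺ (U-mono t≤t′ x∈U , x∈D)

    -- an element whose colour sits at position s is not spanned by X ∪ Z s ⊆ U s
    rk-step : ∀ X {s} → s < K → X ⊆ U s →
              rk (X ∪ Z s) + count Dcol (suc s) ≤ rk (X ∪ Z (suc s)) + count Dcol s
    rk-step X {s} s<K X⊆ with colourAt s<K ∈? Dcol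
    ... | no j∉ = begin
      rk (X ∪ Z s) + count Dcol (suc s)     ≡⟨ cong (rk (X ∪ Z s) +_) (count-suc-∉ (pos-colourAt s<K) j∉) ⟩
      rk (X ∪ Z s) + count Dcol s           ≤⟨ +-monoˡ-≤ (count Dcol s) (rk-mono (∪-monoʳ X (Z-mono (n≤1+n s)))) ⟩
      rk (X ∪ Z (suc s)) + count Dcol s     ∎
      where open ≤-Reasoning
    ... | yes j∈ with e-colouring (colourAt s<K)
    ...   | x , x∈E , ex≡j = begin
      rk (X ∪ Z s) + count Dcol (suc s)     ≡⟨ cong (rk (X ∪ Z s) +_) (count-suc-∈ (pos-colourAt s<K) j∈) ⟩
      rk (X ∪ Z s) + suc (count Dcol s)     ≡⟨ +-suc _ _ ⟩
      suc (rk (X ∪ Z s)) + count Dcol s     ≤⟨ +-monoˡ-≤ (count Dcol s) (begin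
        suc (rk (X ∪ Z s))                    ≤⟨ p-lower x x∈E (X ∪ Z s) (λ y∈ → U⊆E (X∪Z⊆ y∈))
                                                     (λ y y∈ → subst (p y <_) (sym px≡s) (U⁻ (X∪Z⊆ y∈))) ⟩
        rk (⁅ x ⁆ ∪ (X ∪ Z s))                ≤⟨ rk-mono (∪-least (⁅x⁆⊆ (q⊆p∪q X _ x∈Z))
                                                                 (∪-monoʳ X (Z-mono (n≤1+n s)))) ⟩
        rk (X ∪ Z (suc s))                    ∎) ⟩
      rk (X ∪ Z (suc s)) + count Dcol s     ∎
      where
      open ≤-Reasoning
      px≡s : p x ≡ s
      px≡s = trans (cong pos ex≡j) (pos-colourAt s<K)
      X∪Z⊆ : X ∪ Z s ⊆ U s
      X∪Z⊆ = ∪-least X⊆ (p∩q⊆p _ _)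
      x∈Z : x ∈ Z (suc s)
      x∈Z = x∈p∩q⁺ (U⁺ x∈E (s≤s (≤-reflexive px≡s)) , D-coloured x x∈E (subst (_∈ Dcol) (sym ex≡j) j∈))

    rk-chain : ∀ X {t t′} → t ≤ t′ → t′ ≤ K → X ⊆ U t →
               rk (X ∪ Z t) + count Dcol t′ ≤ rk (X ∪ Z t′) + count Dcol t
    rk-chain X t≤t′ t′≤K X⊆ = telescope-≤ (λ s → rk (X ∪ Z s)) (count Dcol) t≤t′
      λ s t≤s s<t′ → rk-step X (<-≤-trans s<t′ t′≤K) (⊆-trans X⊆ (U-mono t≤s))

    rk-Z : rk D ≤ ∣ Dcol ∣ → ∀ {t} → t ≤ K → rk (Z t) ≡ count Dcol t
    rk-Z rk-D≤ {t} t≤K = ≤-antisym (+-cancelʳ-≤ ∣ Dcol ∣ _ _ (begin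
      rk (Z t) + ∣ Dcol ∣           ≡⟨ cong₂ _+_ (cong rk (∪-identityˡ (Z t))) (count-K Dcol) ⟨
      rk (⊥ ∪ Z t) + count Dcol K  ≤⟨ rk-chain ⊥ t≤K ≤-refl ⊥⊆ ⟩
      rk (⊥ ∪ Z K) + count Dcol t  ≤⟨ +-monoˡ-≤ (count Dcol t) (≤-trans (rk-mono (∪-least ⊥⊆ (p∩q⊆q _ _))) rk-D≤) ⟩
      ∣ Dcol ∣ + count Dcol t       ≡⟨ +-comm ∣ Dcol ∣ (count Dcol t) ⟩
      count Dcol t + ∣ Dcol ∣       ∎)) (begin
      count Dcol t                 ≤⟨ m≤n+m _ _ ⟩
      rk (⊥ ∪ Z 0) + count Dcol t  ≤⟨ rk-chain ⊥ z≤n t≤K ⊥⊆ ⟩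
      rk (⊥ ∪ Z t) + count Dcol 0  ≡⟨ cong₂ _+_ (cong rk (∪-identityˡ (Z t))) (count-0 Dcol) ⟩
      rk (Z t) + 0                 ≡⟨ +-identityʳ _ ⟩
      rk (Z t)                     ∎)
      where open ≤-Reasoning

  module All = Part E ⊤ (λ x x∈E _ → x∈E)
  module Left = Part F left (λ x x∈E ex∈left → left⇒F x x∈E (∈-select⁻ (λ j → toℕ j <? k₁) ex∈left))

  ∣left∣≡k₁ : ∣ left ∣ ≡ k₁
  ∣left∣≡k₁ = ∣toℕ<m∣≡m k₁ k₂

  rk-U : ∀ {t} → t ≤ K → rk (U t) ≡ count ⊤ t
  rk-U {t} t≤K = trans (cong rk (⊆-antisym (∩-greatest ⊆-refl U⊆E) (p∩q⊆p _ _)))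
                       (All.rk-Z (≤-reflexive (trans rk-E (sym (∣⊤∣≡n K)))) t≤K)

  rk-U∩F : ∀ {t} → t ≤ K → rk (U t ∩ F) ≡ count left t
  rk-U∩F = Left.rk-Z (≤-reflexive (trans rk-F (sym ∣left∣≡k₁)))

  rk-∪F-lower : ∀ X {t} → t ≤ K → X ⊆ U t → rk X + k₁ ≤ rk (X ∪ F) + count left t
  rk-∪F-lower X {t} t≤K X⊆ = begin
    rk X + k₁                     ≡⟨ cong (rk X +_) (trans (sym ∣left∣≡k₁) (sym (count-K left))) ⟩
    rk X + count left K           ≤⟨ +-monoˡ-≤ (count left K) (rk-mono (p⊆p∪q _)) ⟩
    rk (X ∪ Left.Z t) + count left K ≤⟨ Left.rk-chain X t≤K ≤-refl X⊆ ⟩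
    rk (X ∪ Left.Z K) + count left t ≤⟨ +-monoˡ-≤ (count left t) (rk-mono (∪-monoʳ X (p∩q⊆q _ _))) ⟩
    rk (X ∪ F) + count left t     ∎
    where open ≤-Reasoning

  rk-U∪F : ∀ {t} → t ≤ K → rk (U t ∪ F) ≡ k₁ + count (∁ left) t
  rk-U∪F {t} t≤K = ≤-antisym (+-cancelʳ-≤ (count left t) _ _ (begin
    rk (U t ∪ F) + count left t              ≡⟨ cong (rk (U t ∪ F) +_) (rk-U∩F t≤K) ⟨
    rk (U t ∪ F) + rk (U t ∩ F)              ≤⟨ rk-submodular (U t) F ⟩
    rk (U t) + rk F                          ≡⟨ cong₂ _+_ (trans (rk-U t≤K) (count-⊤ t)) rk-F ⟩
    (count left t + count (∁ left) t) + k₁   ≡⟨ rotate (count left t) (count (∁ left) t) k₁ ⟩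
    (k₁ + count (∁ left) t) + count left t   ∎)) (+-cancelʳ-≤ (count left t) _ _ (begin
    (k₁ + count (∁ left) t) + count left t   ≡⟨ rotate (count left t) (count (∁ left) t) k₁ ⟨
    (count left t + count (∁ left) t) + k₁   ≡⟨ cong (_+ k₁) (trans (rk-U t≤K) (count-⊤ t)) ⟨
    rk (U t) + k₁                            ≤⟨ rk-∪F-lower (U t) t≤K ⊆-refl ⟩
    rk (U t ∪ F) + count left t              ∎))
    where open ≤-Reasoning

  -- N′ is M|F or M/F, and its colouring c′ is e read through an injection into the colours Dcol
  module Minor (N′ : Matroid n) (D′ : Subset n) (Dcol : Subset K) {k′} (inj : Fin k′ → Fin K)
    (inj-injective : ∀ {a b} → inj a ≡ inj b → a ≡ b) (inj∈Dcol : ∀ j → inj j ∈ Dcol)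
    (ground′≡ : ground (sys N′) ≡ E ∩ D′)
    (c′ : Fin n → Fin k′) (e≡inj∘c′ : ∀ x → x ∈ E → x ∈ D′ → e x ≡ inj (c′ x))
    (rk′-U∩D′ : ∀ {t} → t ≤ K → Rank.rk N′ (U t ∩ D′) ≡ count Dcol t)
    (unspanned′ : ∀ x → x ∈ E → x ∈ D′ → Rank.rk N′ (U (p x) ∩ D′) < Rank.rk N′ (⁅ x ⁆ ∪ (U (p x) ∩ D′)))
    where
    private
      module N′ = Rank N′
      E′ = ground (sys N′)

    f : Fin k′ → ℕ
    f j = pos (inj j)

    E′⁻ : ∀ {x} → x ∈ E′ → x ∈ E × x ∈ D′
    E′⁻ x∈ = x∈p∩q⁻ E D′ (subst (_ ∈_) ground′≡ x∈)

    E′⁺ : ∀ {x} → x ∈ E → x ∈ D′ → x ∈ E′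
    E′⁺ x∈E x∈D′ = subst (_ ∈_) (sym ground′≡) (x∈p∩q⁺ (x∈E , x∈D′))

    p≡f∘c′ : ∀ {x} → x ∈ E → x ∈ D′ → p x ≡ f (c′ x)
    p≡f∘c′ x∈E x∈D′ = cong pos (e≡inj∘c′ _ x∈E x∈D′)

    class-isCut : ∀ j → IsCut (restrict (sys N′) (E′ ∩ tabulate (λ x → ⌊ f (c′ x) ≤? f j ⌋)))
                                (colourClass (sys N′) c′ j)
    class-isCut j = Cuts.hyperplane-complement-isCut N′ T⊆ W′⊆ disjoint cover rk′≡ T-unspanned
      where
      q = f j
      q<K : q < K
      q<K = toℕ<n (σ ⟨$⟩ˡ inj j)
      W = E′ ∩ tabulate (λ x → ⌊ f (c′ x) ≤? q ⌋)
      W′ = U q ∩ D′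
      T = colourClass (sys N′) c′ j
      W⁺ : ∀ {x} → x ∈ E → x ∈ D′ → p x ≤ q → x ∈ E′ ∩ W
      W⁺ x∈E x∈D′ px≤q = x∈p∩q⁺ (E′⁺ x∈E x∈D′ , x∈p∩q⁺ (E′⁺ x∈E x∈D′ ,
                           ∈-select⁺ (λ y → f (c′ y) ≤? q) (subst (_≤ q) (p≡f∘c′ x∈E x∈D′) px≤q)))
      W⁻ : ∀ {x} → x ∈ E′ ∩ W → x ∈ E × x ∈ D′ × p x ≤ q
      W⁻ x∈ = let (x∈E , x∈D′) = E′⁻ (p∩q⊆p _ _ x∈) in
        x∈E , x∈D′ , subst (_≤ q) (sym (p≡f∘c′ x∈E x∈D′)) (∈-select⁻ (λ y → f (c′ y) ≤? q) (p∩q⊆q _ _ (p∩q⊆q _ _ x∈)))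
      T⁻ : ∀ {x} → x ∈ T → x ∈ E × x ∈ D′ × p x ≡ q
      T⁻ x∈ = let (x∈E , x∈D′) = E′⁻ (p∩q⊆p _ _ x∈) in
        x∈E , x∈D′ , trans (p≡f∘c′ x∈E x∈D′) (cong f (∈-select⁻ (λ y → c′ y ≟F j) (p∩q⊆q _ _ x∈)))
      T⊆ : T ⊆ E′ ∩ W
      T⊆ x∈ = let (x∈E , x∈D′ , px≡q) = T⁻ x∈ in W⁺ x∈E x∈D′ (≤-reflexive px≡q)
      W′⊆ : W′ ⊆ E′ ∩ W
      W′⊆ x∈ = let (x∈U , x∈D′) = x∈p∩q⁻ _ _ x∈ in W⁺ (U⊆E x∈U) x∈D′ (<⇒≤ (U⁻ x∈U))
      disjoint : ∀ x → x ∈ T → x ∉ W′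
      disjoint x x∈T x∈W′ = <-irrefl (proj₂ (proj₂ (T⁻ x∈T))) (U⁻ (p∩q⊆p _ _ x∈W′))
      cover : E′ ∩ W ⊆ W′ ∪ T
      cover {x} x∈ with W⁻ x∈
      ... | x∈E , x∈D′ , px≤q with m≤n⇒m<n∨m≡n px≤q
      ...   | inj₁ px<q = p⊆p∪q T (x∈p∩q⁺ (U⁺ x∈E px<q , x∈D′))
      ...   | inj₂ px≡q = q⊆p∪q W′ T (x∈p∩q⁺ (E′⁺ x∈E x∈D′ , ∈-select⁺ (λ y → c′ y ≟F j)
                            (inj-injective (pos-injective (trans (sym (p≡f∘c′ x∈E x∈D′)) px≡q)))))
      E′∩W≡ : E′ ∩ W ≡ U (suc q) ∩ D′
      E′∩W≡ = ⊆-antisym (λ x∈ → let (x∈E , x∈D′ , px≤q) = W⁻ x∈ in x∈p∩q⁺ (U⁺ x∈E (s≤s px≤q) , x∈D′))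
                        (λ x∈ → let (x∈U , x∈D′) = x∈p∩q⁻ _ _ x∈ in W⁺ (U⊆E x∈U) x∈D′ (s≤s⁻¹ (U⁻ x∈U)))
      rk′≡ : N′.rk (E′ ∩ W) ≡ suc (N′.rk W′)
      rk′≡ = begin
        N′.rk (E′ ∩ W)           ≡⟨ cong N′.rk E′∩W≡ ⟩
        N′.rk (U (suc q) ∩ D′)   ≡⟨ rk′-U∩D′ q<K ⟩
        count Dcol (suc q)       ≡⟨ count-suc-∈ refl (inj∈Dcol j) ⟩
        suc (count Dcol q)       ≡⟨ cong suc (rk′-U∩D′ (<⇒≤ q<K)) ⟨
        suc (N′.rk W′)           ∎
        where open ≡-Reasoning
      T-unspanned : ∀ x → x ∈ T → N′.rk W′ < N′.rk (⁅ x ⁆ ∪ W′)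
      T-unspanned x x∈T = let (x∈E , x∈D′ , px≡q) = T⁻ x∈T in
        subst (λ t → N′.rk (U t ∩ D′) < N′.rk (⁅ x ⁆ ∪ (U t ∩ D′))) px≡q (unspanned′ x x∈E x∈D′)

    minor-standard : IsStandard (sys N′) c′
    minor-standard = StandardFromOrder.standard-from-order (sys N′) c′ f (λ fa≡fb → inj-injective (pos-injective fa≡fb))
                                                           class-isCut

  restriction-standard : (c₁ : Fin n → Fin k₁) → (∀ x → x ∈ E → x ∈ F → e x ≡ c₁ x ↑ˡ k₂) →
                         IsStandard (restrict S F) c₁
  restriction-standard c₁ e≡ = Minor.minor-standard (restriction M F) F left (_↑ˡ k₂) (↑ˡ-injective k₂ _ _)
    (λ j → ∈-select⁺ (λ i → toℕ i <? k₁) (subst (_< k₁) (sym (toℕ-↑ˡ j k₂)) (toℕ<n j)))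
    refl c₁ e≡ (λ t≤K → trans (rk-restriction-⊆ M (p∩q⊆q _ _)) (rk-U∩F t≤K)) unspanned
    where
    module R = Rank (restriction M F)
    unspanned : ∀ x → x ∈ E → x ∈ F → R.rk (U (p x) ∩ F) < R.rk (⁅ x ⁆ ∪ (U (p x) ∩ F))
    unspanned x x∈E x∈F = subst₂ _<_ (sym (rk-restriction-⊆ M (p∩q⊆q _ _)))
                                     (sym (rk-restriction-⊆ M (∪-least (⁅x⁆⊆ x∈F) (p∩q⊆q _ _))))
      (p-lower x x∈E _ (λ y∈ → U⊆E (p∩q⊆p _ _ y∈)) λ y y∈ → U⁻ (p∩q⊆p _ _ y∈))

  contraction-standard : (c₂ : Fin n → Fin k₂) → (∀ x → x ∈ E → x ∉ F → e x ≡ k₁ ↑ʳ c₂ x) →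
                         IsStandard (contract S F) c₂
  contraction-standard c₂ e≡ = Minor.minor-standard (contraction M F) (∁ F) (∁ left) (k₁ ↑ʳ_) (↑ʳ-injective k₁ _ _)
    (λ j → x∉p⇒x∈∁p λ j∈ → <⇒≱ (∈-select⁻ (λ i → toℕ i <? k₁) j∈) (subst (k₁ ≤_) (sym (toℕ-↑ʳ k₁ j)) (m≤m+n k₁ _)))
    refl c₂ (λ x x∈E x∈∁F → e≡ x x∈E (x∈∁p⇒x∉p x∈∁F)) rk-C unspanned
    where
    module C = Rank (contraction M F)
    rk-C : ∀ {t} → t ≤ K → C.rk (U t ∩ ∁ F) ≡ count (∁ left) t
    rk-C {t} t≤K = +-cancelˡ-≡ k₁ _ _ (trans (+-comm k₁ _) (trans (cong (C.rk (U t ∩ ∁ F) +_) (sym rk-F))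
                     (trans (rk-contraction-∩∁ M F (U t)) (rk-U∪F t≤K))))
    unspanned : ∀ x → x ∈ E → x ∈ ∁ F → C.rk (U (p x) ∩ ∁ F) < C.rk (⁅ x ⁆ ∪ (U (p x) ∩ ∁ F))
    unspanned x x∈E x∈∁F = +-cancelʳ-< k₁ _ _ (begin-strict
      C.rk (U q ∩ ∁ F) + k₁                   ≡⟨ trans (+-comm _ k₁) (cong (k₁ +_) (rk-C (<⇒≤ q<K))) ⟩
      k₁ + count (∁ left) q                   <⟨ +-cancelʳ-≤ (count left q) _ _ (begin
        suc (k₁ + count (∁ left) q) + count left q       ≡⟨ cong suc (rotate (count left q) (count (∁ left) q) k₁) ⟨
        suc (count left q + count (∁ left) q) + k₁       ≡⟨ cong (λ c → suc c + k₁) (trans (rk-U (<⇒≤ q<K)) (count-⊤ q)) ⟨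
        suc (rk (U q)) + k₁                              ≤⟨ +-monoˡ-≤ k₁ (p-lower x x∈E (U q) U⊆E λ y → U⁻) ⟩
        rk X + k₁                                        ≤⟨ rk-∪F-lower X q<K X⊆ ⟩
        rk (X ∪ F) + count left (suc q)                  ≡⟨ cong (rk (X ∪ F) +_) (count-suc-∉ refl ex∉left) ⟩
        rk (X ∪ F) + count left q                        ∎) ⟩
      rk (X ∪ F)                              ≤⟨ rk-mono X∪F⊆ ⟩
      rk ((⁅ x ⁆ ∪ (U q ∩ ∁ F)) ∪ F)           ≡⟨ rk-contraction M F _ ⟨
      C.rk (⁅ x ⁆ ∪ (U q ∩ ∁ F)) + rk F       ≡⟨ cong (C.rk (⁅ x ⁆ ∪ (U q ∩ ∁ F)) +_) rk-F ⟩
      C.rk (⁅ x ⁆ ∪ (U q ∩ ∁ F)) + k₁         ∎)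
      where
      open ≤-Reasoning
      q = p x
      q<K : q < K
      q<K = toℕ<n (σ ⟨$⟩ˡ e x)
      X = ⁅ x ⁆ ∪ U q
      X⊆ : X ⊆ U (suc q)
      X⊆ = ∪-least (⁅x⁆⊆ (U⁺ x∈E ≤-refl)) (U-mono (n≤1+n q))
      X∪F⊆ : X ∪ F ⊆ (⁅ x ⁆ ∪ (U q ∩ ∁ F)) ∪ F
      X∪F⊆ = ∪-least (∪-least (λ y∈ → p⊆p∪q F (p⊆p∪q _ y∈)) (⊆-trans (p⊆p∩∁q∪q (U q) F) (∪-monoˡ F (q⊆p∪q ⁅ x ⁆ _))))
                     (q⊆p∪q _ F)
      ex∉left : e x ∉ left
      ex∉left ex∈left = x∈∁p⇒x∉p x∈∁F (left⇒F x x∈E (∈-select⁻ (λ j → toℕ j <? k₁) ex∈left))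

-- Combining colourings of M|F and M/F

module Join (M : Matroid n) (F : Subset n) (F⊆E : F ⊆ ground (sys M)) where
  open Rank M
  module C = Rank (contraction M F)

  join-isColouring : ∀ {k₁ k₂} {e : Fin n → Fin (k₁ + k₂)} →
                     (∀ j → ∃ λ x → x ∈ E ∩ F × e x ≡ j ↑ˡ k₂) → (∀ j → ∃ λ x → x ∈ E ∩ ∁ F × e x ≡ k₁ ↑ʳ j) →
                     IsColouring S (k₁ + k₂) e
  join-isColouring {k₁} left-onto right-onto i with splitAt k₁ i in eq
  ... | inj₁ j = let (x , x∈ , ex≡) = left-onto j in x , p∩q⊆p _ _ x∈ , trans ex≡ (splitAt⁻¹-↑ˡ eq)
  ... | inj₂ j = let (x , x∈ , ex≡) = right-onto j in x , p∩q⊆p _ _ x∈ , trans ex≡ (splitAt⁻¹-↑ʳ eq)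

  join-rainbowCircuitFree : ∀ {k} {e : Fin n → Fin k} →
    RepeatsOnCircuits (restrict S F) e → RepeatsOnCircuits (contract S F) e → RainbowCircuitFree S e
  join-rainbowCircuitFree restriction-rcf contraction-rcf C C-circuit
    with CircuitSplit.circuit-restriction⊎contraction M F C-circuit
  ... | inj₁ C-circuit′ = restriction-rcf C C-circuit′
  ... | inj₂ (C′ , C′⊆C , C′-circuit) = let (x , y , x∈ , y∈ , x≢y , ex≡ey) = contraction-rcf C′ C′-circuit in
                                        x , y , C′⊆C x∈ , C′⊆C y∈ , x≢y , ex≡ey

  rk≡rk-F+rk-contraction : rk E ≡ rk F + C.rk (E ∩ ∁ F)
  rk≡rk-F+rk-contraction = trans (cong rk (sym (⊆-antisym (∪-least ⊆-refl F⊆E) (p⊆p∪q F))))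
                (trans (sym (rk-contraction-∩∁ M F E)) (+-comm _ (rk F)))

  hasRankOf-restriction⇒rk≡ : ∀ {k} → HasRankOf (restrict S F) (E ∩ F) k → rk F ≡ k
  hasRankOf-restriction⇒rk≡ F-rank = sym (trans (Rank.hasRankOf⇒≡rk (restriction M F) F-rank)
                     (trans (rk-restriction-⊆ M (p∩q⊆q E F))
                            (cong rk (⊆-antisym (p∩q⊆q E F) (∩-greatest F⊆E ⊆-refl)))))

restriction-case : ∀ (M : Matroid n) F → IsFlat (sys M) F →
  HasNonStdRPRCFColouring (restrict (sys M) F) → HasNonStdRPRCFColouring (sys M)
restriction-case {n} M F F-flat@(F⊆E , _) (k₁ , c₁ , c₁-colouring , c₁-rank , c₁-rcf , c₁-nonstandard) =
  k₁ + k₂ , e , e-colouring , subst (HasRankOf S E) rk-E (rk-hasRankOf E) , e-rcf , e-nonstandard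
  where
  open Rank M
  open Join M F F⊆E
  module Fl = Flag (contraction M F) (contraction-loopless M F F-flat)
  k₂ = C.rk (E ∩ ∁ F)

  e : Fin n → Fin (k₁ + k₂)
  e x with x ∈? E ∩ ∁ F
  ... | yes x∈ = k₁ ↑ʳ fromℕ< (Fl.flag<rk x∈)
  ... | no _ = c₁ x ↑ˡ k₂

  e-F : ∀ {x} → x ∈ F → e x ≡ c₁ x ↑ˡ k₂
  e-F {x} x∈F with x ∈? E ∩ ∁ F
  ... | yes x∈ = ⊥-elim (x∈∁p⇒x∉p (p∩q⊆q _ _ x∈) x∈F)
  ... | no _ = refl

  toℕ-e-∁F : ∀ {x} → x ∈ E ∩ ∁ F → toℕ (e x) ≡ k₁ + Fl.flag x
  toℕ-e-∁F {x} x∈ with x ∈? E ∩ ∁ F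
  ... | yes _ = trans (toℕ-↑ʳ k₁ _) (cong (k₁ +_) (toℕ-fromℕ< _))
  ... | no x∉ = ⊥-elim (x∉ x∈)

  left⇒F : ∀ x → x ∈ E → toℕ (e x) < k₁ → x ∈ F
  left⇒F x x∈E ex<k₁ = decidable-stable (x ∈? F) λ x∉F →
    <⇒≱ ex<k₁ (subst (k₁ ≤_) (sym (toℕ-e-∁F (x∈p∩q⁺ (x∈E , x∉p⇒x∈∁p x∉F)))) (m≤m+n k₁ _))

  rk-F : rk F ≡ k₁
  rk-F = hasRankOf-restriction⇒rk≡ c₁-rank

  rk-E : rk E ≡ k₁ + k₂
  rk-E = trans rk≡rk-F+rk-contraction (cong (_+ k₂) rk-F)

  e-colouring : IsColouring S (k₁ + k₂) e
  e-colouring = join-isColouring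
    (λ j → let (x , x∈ , c₁x≡j) = c₁-colouring j in x , x∈ , trans (e-F (p∩q⊆q _ _ x∈)) (cong (_↑ˡ k₂) c₁x≡j))
    (λ j → let (x , x∈ , flag≡j) = Fl.flag-surjective (toℕ<n j) in
           x , x∈ , toℕ-injective (trans (toℕ-e-∁F x∈) (trans (cong (k₁ +_) flag≡j) (sym (toℕ-↑ʳ k₁ j)))))

  e-rcf : RainbowCircuitFree S e
  e-rcf = join-rainbowCircuitFree (RepeatsOnCircuits-map same-on-F c₁-rcf)
                                  (RepeatsOnCircuits-map same-off-F Fl.flag-repeatsOnCircuits)
    where
    same-on-F : ∀ {x y} → x ∈ E ∩ F → y ∈ E ∩ F → c₁ x ≡ c₁ y → e x ≡ e y
    same-on-F x∈ y∈ c₁x≡c₁y = trans (e-F (p∩q⊆q _ _ x∈)) (trans (cong (_↑ˡ k₂) c₁x≡c₁y) (sym (e-F (p∩q⊆q _ _ y∈))))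
    same-off-F : ∀ {x y} → x ∈ E ∩ ∁ F → y ∈ E ∩ ∁ F → Fl.flag x ≡ Fl.flag y → e x ≡ e y
    same-off-F x∈ y∈ flag≡ = toℕ-injective (trans (toℕ-e-∁F x∈) (trans (cong (k₁ +_) flag≡) (sym (toℕ-e-∁F y∈))))

  e-nonstandard : ¬ IsStandard S e
  e-nonstandard e-standard = c₁-nonstandard
    (StandardJoin.restriction-standard M F e e-colouring e-standard left⇒F rk-F rk-E c₁ λ x _ → e-F)

contraction-case : ∀ (M : Matroid n) F → Loopless (sys M) → IsFlat (sys M) F →
  HasNonStdRPRCFColouring (contract (sys M) F) → HasNonStdRPRCFColouring (sys M)
contraction-case {n} M F loopless (F⊆E , _) (k₂ , c₂ , c₂-colouring , c₂-rank , c₂-rcf , c₂-nonstandard) =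
  k₁ + k₂ , e , e-colouring , subst (HasRankOf S E) rk-E (rk-hasRankOf E) , e-rcf , e-nonstandard
  where
  open Rank M
  open Join M F F⊆E
  module R = Rank (restriction M F)
  module Fl = Flag (restriction M F) (restriction-loopless M F loopless)
  k₁ = R.rk (E ∩ F)

  e : Fin n → Fin (k₁ + k₂)
  e x with x ∈? F
  ... | yes x∈F = fromℕ< (Fl.flag<rk (x∈p∩q⁺ (F⊆E x∈F , x∈F))) ↑ˡ k₂
  ... | no _ = k₁ ↑ʳ c₂ x

  toℕ-e-F : ∀ {x} → x ∈ F → toℕ (e x) ≡ Fl.flag x
  toℕ-e-F {x} x∈F with x ∈? F
  ... | yes _ = trans (toℕ-↑ˡ _ k₂) (toℕ-fromℕ< _)
  ... | no x∉F = ⊥-elim (x∉F x∈F)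

  e-∁F : ∀ {x} → x ∉ F → e x ≡ k₁ ↑ʳ c₂ x
  e-∁F {x} x∉F with x ∈? F
  ... | yes x∈F = ⊥-elim (x∉F x∈F)
  ... | no _ = refl

  left⇒F : ∀ x → x ∈ E → toℕ (e x) < k₁ → x ∈ F
  left⇒F x x∈E ex<k₁ = decidable-stable (x ∈? F) λ x∉F →
    <⇒≱ ex<k₁ (subst (k₁ ≤_) (sym (trans (cong toℕ (e-∁F x∉F)) (toℕ-↑ʳ k₁ (c₂ x)))) (m≤m+n k₁ _))

  rk-F : rk F ≡ k₁
  rk-F = hasRankOf-restriction⇒rk≡ (R.rk-hasRankOf (E ∩ F))

  rk-E : rk E ≡ k₁ + k₂
  rk-E = trans rk≡rk-F+rk-contraction (cong₂ _+_ rk-F (sym (C.hasRankOf⇒≡rk c₂-rank)))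

  e-colouring : IsColouring S (k₁ + k₂) e
  e-colouring = join-isColouring
    (λ j → let (x , x∈ , flag≡j) = Fl.flag-surjective (toℕ<n j) in
           x , x∈ , toℕ-injective (trans (toℕ-e-F (p∩q⊆q _ _ x∈)) (trans flag≡j (sym (toℕ-↑ˡ j k₂)))))
    (λ j → let (x , x∈ , c₂x≡j) = c₂-colouring j in
           x , x∈ , trans (e-∁F (x∈∁p⇒x∉p (p∩q⊆q _ _ x∈))) (cong (k₁ ↑ʳ_) c₂x≡j))

  e-rcf : RainbowCircuitFree S e
  e-rcf = join-rainbowCircuitFree (RepeatsOnCircuits-map same-on-F Fl.flag-repeatsOnCircuits)
                                  (RepeatsOnCircuits-map same-off-F c₂-rcf)
    where
    same-on-F : ∀ {x y} → x ∈ E ∩ F → y ∈ E ∩ F → Fl.flag x ≡ Fl.flag y → e x ≡ e y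
    same-on-F x∈ y∈ flag≡ =
      toℕ-injective (trans (toℕ-e-F (p∩q⊆q _ _ x∈)) (trans flag≡ (sym (toℕ-e-F (p∩q⊆q _ _ y∈)))))
    same-off-F : ∀ {x y} → x ∈ E ∩ ∁ F → y ∈ E ∩ ∁ F → c₂ x ≡ c₂ y → e x ≡ e y
    same-off-F x∈ y∈ c₂x≡c₂y = trans (e-∁F (x∈∁p⇒x∉p (p∩q⊆q _ _ x∈))) (trans (cong (k₁ ↑ʳ_) c₂x≡c₂y)
                                      (sym (e-∁F (x∈∁p⇒x∉p (p∩q⊆q _ _ y∈)))))

  e-nonstandard : ¬ IsStandard S e
  e-nonstandard e-standard = c₂-nonstandard
    (StandardJoin.contraction-standard M F e e-colouring e-standard left⇒F rk-F rk-E c₂ λ x _ → e-∁F)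

lemma15 : ∀ {n : ℕ} (M : Matroid n) (F : Subset n) →
    Loopless (sys M) → IsFlat (sys M) F →
    HasNonStdRPRCFColouring (restrict (sys M) F) ⊎
      HasNonStdRPRCFColouring (contract (sys M) F) →
    HasNonStdRPRCFColouring (sys M)
lemma15 M F loopless F-flat (inj₁ restriction-colouring) = restriction-case M F F-flat restriction-colouring
lemma15 M F loopless F-flat (inj₂ contraction-colouring) = contraction-case M F loopless F-flat contraction-colouring
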